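{- Let $n,k\ge1$. Start with a deck of $n$ cards labeled $1,\dots,n$ from top to bottom, all face down. Step 1: choose $(j_1,\dots,j_k)$ with probability $\binom{n}{j_1,\dots,j_k}/k^n$ and cut the deck into $k$ consecutive stacks (from the top) of sizes $j_1,\dots,j_k$; if $k$ is odd flip over (reverse and turn face up) the even-numbered stacks, and if $k$ is even flip over the odd-numbered stacks. Step 2: choose uniformly at random one of the $\binom{n}{j_1,\dots,j_k}$ interleavings of the stacks preserving the order within each stack. Encode the result as the signed permutation $\sigma\in C_n$ with $\sigma(i)=\pm(\text{label of the card in position } i)$, the sign being negative iff that card is face up. Then for every $\sigma\in C_n$ the probability of obtaining $\sigma$ is $x_k(\sigma^{ -1})$.
   Context: $C_n$ is the group of signed permutations of $\{1,\dots,n\}$ (bijections $w$ of $\{\pm1,\dots,\pm n\}$ with $w(-i)=-w(i)$), acting on $\mathbb{R}^n$ by $w(e_i)=\mathrm{sgn}(w(i))e_{|w(i)|}$; the Weyl group of type $C_n$ with positive roots $e_i-e_j$ ($i<j$), $e_i+e_j$, $2e_i$, simple roots $\alpha_i=e_i-e_{i+1}$ ($1\le i\le n-1$), $\alpha_n=2e_n$, $\alpha_0=-2e_1$. Let $\Pi=\{\alpha_1,\dots,\alpha_n\}$, $\tilde\Pi=\Pi\cup\{\alpha_0\}$, $Y=\mathbb{Z}^n$ with the standard inner product as pairing, $\mathrm{Cdes}(w)=\{\alpha\in\tilde\Pi:w(\alpha)\text{ negative}\}$. For $I\subseteq\tilde\Pi$, $a_{k,I}$ is the number of $y\in Y$ with: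 if $\alpha_0\in I$: $\langle-\alpha_0,y\rangle=k$, $\langle\alpha_i,y\rangle=0$ for $\alpha_i\in I\setminus\{\alpha_0\}$, $\langle\alpha_i,y\rangle>0$ for $\alpha_i\in\tilde\Pi\setminus I$; if $\alpha_0\notin I$: $\langle-\alpha_0,y\rangle<k$, $\langle\alpha_i,y\rangle=0$ for $\alpha_i\in I$, $\langle\alpha_i,y\rangle>0$ for $\alpha_i\in\Pi\setminus I$. $x_k(w)=k^{ -n}\sum_{I\subseteq\tilde\Pi\setminus\mathrm{Cdes}(w)}a_{k,I}$. -}

module Defs where

open import Data.Bool using (Bool; true; false; not; if_then_else_)
open import Data.Nat as ℕ using (ℕ; zero; suc; _≡ᵇ_)
open import Data.Nat using (_!)
open import Data.Nat.ListAction using (product)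
open import Data.Integer as ℤ using (ℤ; +_; -_; _<_)
import Data.Integer.Properties as ℤP
open import Data.Fin using (Fin; zero; suc; toℕ; _<?_) renaming (_<_ to _<ᶠ_)
open import Data.Fin.Properties using (any?; all?)
open import Data.Fin.Subset using (Subset; _∈_; _∉_)
open import Data.Fin.Subset.Properties using (_∈?_)
open import Data.Fin.Permutation using (Permutation′; _⟨$⟩ʳ_; _⟨$⟩ˡ_; flip)
open import Data.List as List using (List; []; _∷_; filter; length; reverse; take; drop; allFin; concatMap; upTo)
open import Data.List.Relation.Unary.Unique.Propositional using (Unique)
open import Data.List.Membership.Propositional using () renaming (_∈_ to _∈ₗ_)
import Data.List.Properties as LP
open import Data.Vec as Vec using (Vec; []; _∷_; lookup; tabulate; _[_]≔_)
import Data.Vec.Properties as VP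
open import Data.Rational as ℚ using (ℚ; 0ℚ; _/_)
open import Data.Product using (Σ; ∃; _×_; _,_; proj₁; proj₂)
import Data.Product.Properties as PP
open import Data.Sum using (_⊎_)
open import Function.Bundles using (_⇔_)
open import Relation.Nullary using (Dec; ¬_; ¬?)
open import Relation.Nullary.Decidable using (_×-dec_; _⊎-dec_; _→-dec_)
open import Relation.Binary.PropositionalEquality using (_≡_)
import Data.Bool.Properties as BP

allVec : ∀ {A : Set} → List A → (m : ℕ) → List (Vec A m)
allVec xs zero    = [] ∷ []
allVec xs (suc m) = concatMap (λ x → List.map (x ∷_) (allVec xs m)) xs

sumℤ : ∀ {n} → (Fin n → ℤ) → ℤ
sumℤ {zero}  f = + 0
sumℤ {suc n} f = f zero ℤ.+ sumℤ (λ i → f (suc i))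

sumℚ : List ℚ → ℚ
sumℚ = List.foldr ℚ._+_ 0ℚ

-- a / d as a rational number (d = 0 never occurs in our uses; then 0)
ratio : ℕ → ℕ → ℚ
ratio a zero    = 0ℚ
ratio a (suc d) = (+ a) / suc d

HasCard : ∀ {A : Set} → (A → Set) → ℕ → Set
HasCard {A} P c = Σ (List A) λ ys → Unique ys × (∀ y → (y ∈ₗ ys) ⇔ P y) × (length ys ≡ c)

-- Signed permutations of {1..n}:  w(i) = (if neg i then - else +) (π(i)+1)
-- (Fin is 0-indexed: i : Fin n stands for i+1.)

record SignedPerm (n : ℕ) : Set where
  field
    π   : Permutation′ n
    neg : Fin n → Bool
open SignedPerm public

inv : ∀ {n} → SignedPerm n → SignedPerm n
inv w = record { π = flip (π w) ; neg = λ j → neg w (π w ⟨$⟩ˡ j) }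

Vecℤ : ℕ → Set
Vecℤ n = Fin n → ℤ

unit : ∀ {n} → Fin n → Vecℤ n
unit i j = if toℕ i ≡ᵇ toℕ j then + 1 else + 0

-- action w(e_i) = sgn(w(i)) e_{|w(i)|}, extended linearly
act : ∀ {n} → SignedPerm n → Vecℤ n → Vecℤ n
act w v j = let i = π w ⟨$⟩ˡ j in (if neg w i then -_ (v i) else v i)

IsPosRoot : ∀ {n} → Vecℤ n → Set
IsPosRoot {n} v =
    (∃ λ i → ∃ λ j → (i <ᶠ j) × (∀ t → v t ≡ unit i t ℤ.- unit j t))
  ⊎ (∃ λ i → ∃ λ j → (i <ᶠ j) × (∀ t → v t ≡ unit i t ℤ.+ unit j t))
  ⊎ (∃ λ i → ∀ t → v t ≡ (+ 2) ℤ.* unit i t)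

IsNegRoot : ∀ {n} → Vecℤ n → Set
IsNegRoot v = IsPosRoot (λ t → -_ (v t))

isPosRoot? : ∀ {n} (v : Vecℤ n) → Dec (IsPosRoot v)
isPosRoot? v =
      any? (λ i → any? (λ j → (i <? j) ×-dec all? (λ t → v t ℤ.≟ (unit i t ℤ.- unit j t))))
  ⊎-dec any? (λ i → any? (λ j → (i <? j) ×-dec all? (λ t → v t ℤ.≟ (unit i t ℤ.+ unit j t))))
  ⊎-dec any? (λ i → all? (λ t → v t ℤ.≟ ((+ 2) ℤ.* unit i t)))

isNegRoot? : ∀ {n} (v : Vecℤ n) → Dec (IsNegRoot v)
isNegRoot? v = isPosRoot? (λ t → -_ (v t))

-- Simple roots of C_n with n = suc m.  Index set  Π̃ = Fin (suc n):
--   zero    ↦ α₀ = -2 e₁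
--   suc i   ↦ α_{i+1}  ( = e_{i+1} - e_{i+2} for i+1 < n,  α_n = 2 e_n )

simpleRoot : (m : ℕ) → Fin (suc (suc m)) → Vecℤ (suc m)
simpleRoot m zero    j = if toℕ j ≡ᵇ 0 then -_ (+ 2) else + 0
simpleRoot m (suc i) j with toℕ i ≡ᵇ m
... | true  = if toℕ j ≡ᵇ toℕ i then + 2 else + 0
... | false = if toℕ j ≡ᵇ toℕ i then + 1
              else (if toℕ j ≡ᵇ suc (toℕ i) then -_ (+ 1) else + 0)

⟪_,_⟫ : ∀ {n} → Vecℤ n → Vec ℤ n → ℤ
⟪ v , y ⟫ = sumℤ (λ j → v j ℤ.* lookup y j)

InCdes : (m : ℕ) → SignedPerm (suc m) → Fin (suc (suc m)) → Set
InCdes m w a = IsNegRoot (act w (simpleRoot m a))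

AvoidsCdes : (m : ℕ) → SignedPerm (suc m) → Subset (suc (suc m)) → Set
AvoidsCdes m w I = ∀ a → a ∈ I → ¬ InCdes m w a

avoidsCdes? : (m : ℕ) (w : SignedPerm (suc m)) (I : Subset (suc (suc m))) → Dec (AvoidsCdes m w I)
avoidsCdes? m w I = all? (λ a → (a ∈? I) →-dec ¬? (isNegRoot? (act w (simpleRoot m a))))

ACond : (m k : ℕ) → Subset (suc (suc m)) → Vec ℤ (suc m) → Set
ACond m k I y =
    (zero ∈ I → ⟪ (λ j → -_ (simpleRoot m zero j)) , y ⟫ ≡ + k)
  × (zero ∉ I → ⟪ (λ j → -_ (simpleRoot m zero j)) , y ⟫ < + k)
  × (∀ (i : Fin (suc m)) →
        (suc i ∈ I → ⟪ simpleRoot m (suc i) , y ⟫ ≡ + 0)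
      × (suc i ∉ I → + 0 < ⟪ simpleRoot m (suc i) , y ⟫))

allSubsets : ∀ n → List (Subset n)
allSubsets n = allVec (true ∷ false ∷ []) n

xk : (m k : ℕ) → (Subset (suc (suc m)) → ℕ) → SignedPerm (suc m) → ℚ
xk m k a w = ratio 1 (k ℕ.^ suc m)
  ℚ.* sumℚ (List.map (λ I → ratio (a I) 1) (filter (avoidsCdes? m w) (allSubsets (suc (suc m)))))

-- The shuffle.  A card is (faceUp , label).

Card : Set
Card = Bool × ℕ

card-≟ : (c d : Card) → Dec (c ≡ d)
card-≟ = PP.≡-dec BP._≟_ ℕ._≟_

deck-≟ : (c d : List Card) → Dec (c ≡ d)
deck-≟ = LP.≡-dec card-≟

initialDeck : ℕ → List Card
initialDeck n = List.map (λ l → (false , suc l)) (upTo n)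

cut : ∀ {A : Set} {k} → Vec ℕ k → List A → Vec (List A) k
cut []       xs = []
cut (j ∷ js) xs = take j xs ∷ cut js (drop j xs)

turnOver : List Card → List Card
turnOver s = List.map (λ c → (not (proj₁ c) , proj₂ c)) (reverse s)

isEven : ℕ → Bool
isEven zero          = true
isEven (suc zero)    = false
isEven (suc (suc n)) = isEven n

-- is the stack with (1-based) number s flipped?  k odd: even-numbered; k even: odd-numbered
flipped : (k s : ℕ) → Bool
flipped k s = if isEven k then not (isEven s) else isEven s

stacks : (n : ℕ) {k : ℕ} → Vec ℕ k → Vec (List Card) k
stacks n {k} j = tabulate (λ r → let s = lookup (cut j (initialDeck n)) r in
                                 if flipped k (suc (toℕ r)) then turnOver s else s)

-- interleave: the word u says from which stack each successive card (top to bottom) comes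
interleave : ∀ {k} → List (Fin k) → Vec (List Card) k → List Card
interleave []      st = []
interleave (r ∷ u) st with lookup st r
... | []     = []
... | c ∷ cs = c ∷ interleave u (st [ r ]≔ cs)

counts : ∀ {k n} → Vec (Fin k) n → Vec ℕ k
counts u = tabulate (λ r → Vec.count (λ x → r Data.Fin.≟ x) u)

-- interleavings of stacks of sizes j: words over Fin k with j_r letters r
interleavings : (n : ℕ) {k : ℕ} → Vec ℕ k → List (Vec (Fin k) n)
interleavings n j = filter (λ u → VP.≡-dec ℕ._≟_ (counts u) j) (allVec (allFin _) n)

compositions : (n k : ℕ) → List (Vec ℕ k)
compositions n k = filter (λ j → Vec.sum j ℕ.≟ n)
                          (List.map (Vec.map toℕ) (allVec (allFin (suc n)) k))

multinomial : (n : ℕ) {k : ℕ} → Vec ℕ k → ℚ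
multinomial n j = ratio (n !) (product (List.map _! (Vec.toList j)))

encode : ∀ {n} → SignedPerm n → List Card
encode σ = List.map (λ i → (neg σ i , suc (toℕ (π σ ⟨$⟩ʳ i)))) (allFin _)

prob : (n k : ℕ) → SignedPerm n → ℚ
prob n k σ = sumℚ (List.map
  (λ j → (multinomial n j ℚ.* ratio 1 (k ℕ.^ n))
         ℚ.* ratio (length (filter (λ u → deck-≟ (interleave (Vec.toList u) (stacks n j)) (encode σ))
                                   (interleavings n j)))
                   (length (interleavings n j)))
  (compositions n k))

module Submission where

-- A word u ∈ [k]ⁿ, read from the top of the deck, determines both the cut (its letter counts j) and
-- the interleaving, and the multinomial weight of j cancels the uniform choice among the interleavings:
-- the probability of σ is k⁻ⁿ times the number of words producing σ.  Give a card from the r-th stack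
-- the height k − r.  The words producing σ correspond exactly to the height functions g on labels that are
-- bounded by k − 1, odd exactly at the face-up cards, and, between consecutive labels, either strictly
-- decreasing or constant with the positions in increasing order (decreasing on odd heights).
-- Halving, y_l = ⌈ g l / 2 ⌉, maps these bijectively onto the lattice points y of the regions
-- counted by a_{k,I}, I ⊆ Π̃ ∖ Cdes(σ⁻¹): y may lie on the wall of a simple root exactly when that
-- root is not a descent of σ⁻¹, and the region I of y is the set of walls it lies on.

open import Defs
open import Algebra.Properties.CommutativeSemigroup using (interchange)
import Algebra.Properties.CommutativeMonoid.Sum as CommutativeMonoidSum
open import Data.Bool using (Bool; true; false; if_then_else_; not; T)
open import Data.Empty using (⊥; ⊥-elim)
open import Data.Fin as Fin using (Fin; zero; suc; toℕ; fromℕ; fromℕ<) renaming (_<_ to _<ᶠ_)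
import Data.Fin.Properties as FP
open import Data.Fin.Permutation as Perm using (Permutation′; _⟨$⟩ʳ_; _⟨$⟩ˡ_)
open import Data.Fin.Subset using (Subset; _∈_; _∉_)
open import Data.Fin.Subset.Properties using (_∈?_; ⊆-antisym)
open import Data.Integer as ℤ using (ℤ; +_; -_; ∣_∣; +<+)
import Data.Integer.Properties as ZP
open import Data.List as List using (List; []; _∷_; filter; length; concatMap; allFin; reverse; take; drop; _++_; applyUpTo)
import Data.List.Properties as LP
open import Data.List.Membership.Propositional using (find; lose) renaming (_∈_ to _∈ₗ_)
import Data.List.Membership.Propositional.Properties as MP
open import Data.List.Membership.Propositional.Properties.WithK using (unique∧set⇒bag)
open import Data.List.Relation.Binary.BagAndSetEquality using (∼bag⇒↭)
open import Data.List.Relation.Binary.Disjoint.Propositional using (Disjoint)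
open import Data.List.Relation.Binary.Permutation.Propositional.Properties using (↭-length)
open import Data.List.Relation.Unary.All as All using (All; []; _∷_)
import Data.List.Relation.Unary.All.Properties as AllP
open import Data.List.Relation.Unary.AllPairs as AllPairs using ([]; _∷_)
import Data.List.Relation.Unary.AllPairs.Properties as AllPairsP
open import Data.List.Relation.Unary.Any using (here; there)
open import Data.List.Relation.Unary.Unique.Propositional using (Unique)
import Data.List.Relation.Unary.Unique.Propositional.Properties as UniqueP
open import Data.Nat as ℕ using (ℕ; zero; suc; _≤_; _<_; z≤n; s≤s; _∸_; _!; _≡ᵇ_; ⌈_/2⌉)
import Data.Nat.Properties as NP
open import Data.Nat.ListAction using (sum; product)
open import Data.Nat.Tactic.RingSolver using (solve-∀)
open import Data.Product using (∃; _×_; _,_; proj₁; proj₂)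
open import Data.Rational as ℚ using (ℚ; toℚᵘ)
import Data.Rational.Properties as QP
open import Data.Rational.Unnormalised as U using (mkℚᵘ; *≡*)
import Data.Rational.Unnormalised.Properties as UP
open import Data.Sum using (_⊎_; inj₁; inj₂)
open import Data.Unit using (⊤; tt)
open import Data.Vec as Vec using (Vec; []; _∷_; lookup; _[_]≔_)
import Data.Vec.Properties as VP
open import Data.Vec.Relation.Binary.Pointwise.Extensional using (ext; Pointwise-≡⇒≡)
open import Function.Bundles using (_⇔_; mk⇔; Equivalence)
open import Relation.Binary.Definitions using (tri<; tri≈; tri>)
open import Relation.Binary.PropositionalEquality
open import Relation.Nullary using (Dec; yes; no; does; ¬_)
open import Relation.Nullary.Decidable using (_×-dec_; decidable-stable; dec-true)
open import Relation.Unary using (Decidable)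

open CommutativeMonoidSum NP.+-0-commutativeMonoid using (∑-distrib-+; ∑-comm; sum-permute) renaming (sum to ∑; sum-cong-≗ to ∑-cong)

ofℕ : ℕ → ℚ
ofℕ a = ratio a 1

private
  toℚᵘ-ratio : ∀ a d → toℚᵘ (ratio a (suc d)) U.≃ mkℚᵘ (+ a) d
  toℚᵘ-ratio a d = QP.toℚᵘ-fromℚᵘ (mkℚᵘ (+ a) d)

ofℕ-+ : ∀ a b → ofℕ a ℚ.+ ofℕ b ≡ ofℕ (a ℕ.+ b)
ofℕ-+ a b = QP.toℚᵘ-injective (UP.≃-trans (QP.toℚᵘ-homo-+ (ofℕ a) (ofℕ b))
  (UP.≃-trans (UP.+-cong (toℚᵘ-ratio a 0) (toℚᵘ-ratio b 0))
  (UP.≃-trans (*≡* cross) (UP.≃-sym (toℚᵘ-ratio (a ℕ.+ b) 0)))))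
  where
  cross : (+ a ℤ.* + 1 ℤ.+ + b ℤ.* + 1) ℤ.* + 1 ≡ + (a ℕ.+ b) ℤ.* (+ 1 ℤ.* + 1)
  cross = begin
    (+ a ℤ.* + 1 ℤ.+ + b ℤ.* + 1) ℤ.* + 1 ≡⟨ ZP.*-identityʳ _ ⟩
    + a ℤ.* + 1 ℤ.+ + b ℤ.* + 1           ≡⟨ cong₂ ℤ._+_ (ZP.*-identityʳ (+ a)) (ZP.*-identityʳ (+ b)) ⟩
    + (a ℕ.+ b)                           ≡⟨ ZP.*-identityʳ (+ (a ℕ.+ b)) ⟨
    + (a ℕ.+ b) ℤ.* (+ 1 ℤ.* + 1)         ∎
    where open ≡-Reasoning

ratio-*-cancelʳ : ∀ a d → ratio (a ℕ.* suc d) (suc d) ≡ ofℕ a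
ratio-*-cancelʳ a d = QP.toℚᵘ-injective (UP.≃-trans (toℚᵘ-ratio (a ℕ.* suc d) d)
  (UP.≃-trans (*≡* (trans (ZP.*-identityʳ _) (ZP.pos-* a (suc d)))) (UP.≃-sym (toℚᵘ-ratio a 0))))

ofℕ-*-ratio : ∀ d c → ofℕ (suc d) ℚ.* ratio c (suc d) ≡ ofℕ c
ofℕ-*-ratio d c = QP.toℚᵘ-injective (UP.≃-trans (QP.toℚᵘ-homo-* (ofℕ (suc d)) (ratio c (suc d)))
  (UP.≃-trans (UP.*-cong (toℚᵘ-ratio (suc d) 0) (toℚᵘ-ratio c d))
  (UP.≃-trans (*≡* cross) (UP.≃-sym (toℚᵘ-ratio c 0)))))
  where
  cross : (+ suc d ℤ.* + c) ℤ.* + 1 ≡ + c ℤ.* (+ 1 ℤ.* + suc d)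
  cross = trans (ZP.*-identityʳ _) (trans (ZP.*-comm (+ suc d) (+ c))
            (cong (+ c ℤ.*_) (sym (ZP.*-identityˡ (+ suc d)))))

sumℚ-*ˡ : ∀ {A : Set} (r : ℚ) (f : A → ℚ) xs →
  sumℚ (List.map (λ x → r ℚ.* f x) xs) ≡ r ℚ.* sumℚ (List.map f xs)
sumℚ-*ˡ r f []       = sym (QP.*-zeroʳ r)
sumℚ-*ˡ r f (x ∷ xs) = trans (cong (r ℚ.* f x ℚ.+_) (sumℚ-*ˡ r f xs))
  (sym (QP.*-distribˡ-+ r (f x) _))

sumℚ-ofℕ : ∀ {A : Set} (f : A → ℕ) xs →
  sumℚ (List.map (λ x → ofℕ (f x)) xs) ≡ ofℕ (sum (List.map f xs))
sumℚ-ofℕ f []       = refl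
sumℚ-ofℕ f (x ∷ xs) = trans (cong (ofℕ (f x) ℚ.+_) (sumℚ-ofℕ f xs)) (ofℕ-+ (f x) _)

Unique-length : ∀ {A : Set} {xs ys : List A} → Unique xs → Unique ys →
  (∀ z → z ∈ₗ xs ⇔ z ∈ₗ ys) → length xs ≡ length ys
Unique-length xs! ys! same = ↭-length (∼bag⇒↭ (unique∧set⇒bag xs! ys! (λ {z} → same z)))

∈-allVec : ∀ {A : Set} {xs : List A} → (∀ x → x ∈ₗ xs) → ∀ {m} (v : Vec A m) → v ∈ₗ allVec xs m
∈-allVec every []      = here refl
∈-allVec every (x ∷ v) = MP.∈-concatMap⁺ _ (lose (every x) (MP.∈-map⁺ (x ∷_) (∈-allVec every v)))

Unique-allVec : ∀ {A : Set} {xs : List A} → Unique xs → ∀ m → Unique (allVec xs m)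
Unique-allVec {xs = xs} xs! zero    = [] ∷ []
Unique-allVec {xs = xs} xs! (suc m) =
  UniqueP.concat⁺ (AllP.map⁺ (All.universal blockUnique xs)) (AllPairsP.map⁺ (AllPairs.map disjoint xs!))
  where
  blockUnique : ∀ x → Unique (List.map (x ∷_) (allVec xs m))
  blockUnique x = UniqueP.map⁺ (λ { refl → refl }) (Unique-allVec xs! m)
  disjoint : ∀ {x y} → x ≢ y → Disjoint (List.map (x ∷_) (allVec xs m)) (List.map (y ∷_) (allVec xs m))
  disjoint x≢y (p , q) with MP.∈-map⁻ _ p | MP.∈-map⁻ _ q
  ... | _ , _ , refl | _ , _ , eq = x≢y (cong Vec.head eq)

Unique-map : ∀ {A B : Set} (f : A → B) {xs : List A} → Unique xs →
  (∀ {x y} → x ∈ₗ xs → y ∈ₗ xs → f x ≡ f y → x ≡ y) → Unique (List.map f xs)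
Unique-map f []         inj = []
Unique-map f (x∉ ∷ xs!) inj =
  AllP.map⁺ (All.tabulate λ y∈ fx≡fy → All.lookup x∉ y∈ (inj (here refl) (there y∈) fx≡fy))
  ∷ Unique-map f xs! (λ p q → inj (there p) (there q))

Unique-concatMap : ∀ {I Y : Set} (ys : I → List Y) → (∀ i → Unique (ys i)) →
  (∀ i i' y → y ∈ₗ ys i → y ∈ₗ ys i' → i ≡ i') →
  ∀ {S} → Unique S → Unique (concatMap ys S)
Unique-concatMap ys ys! det {[]}    []        = []
Unique-concatMap ys ys! det {i ∷ S} (i∉ ∷ S!) =
  UniqueP.++⁺ (ys! i) (Unique-concatMap ys ys! det S!) disjoint
  where
  disjoint : Disjoint (ys i) (concatMap ys S)
  disjoint (p , q) with find (MP.∈-concatMap⁻ ys {xs = S} q)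
  ... | i' , i'∈ , q' = All.lookup i∉ i'∈ (det i i' _ p q')

∈-concatMap⇔ : ∀ {I Y : Set} (ys : I → List Y) (S : List I) y →
  y ∈ₗ concatMap ys S ⇔ (∃ λ i → i ∈ₗ S × y ∈ₗ ys i)
∈-concatMap⇔ ys S y = mk⇔ (λ q → find (MP.∈-concatMap⁻ ys {xs = S} q))
  (λ { (i , i∈ , p) → MP.∈-concatMap⁺ ys (lose i∈ p) })

indicator : ∀ {P : Set} → Dec P → ℕ
indicator d = if does d then 1 else 0

length-concatMap : ∀ {I Y : Set} (ys : I → List Y) (S : List I) →
  length (concatMap ys S) ≡ sum (List.map (λ i → length (ys i)) S)
length-concatMap ys []      = refl
length-concatMap ys (i ∷ S) = trans (LP.length-++ (ys i)) (cong (length (ys i) ℕ.+_) (length-concatMap ys S))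

length-filter-++ : ∀ {A : Set} {P : A → Set} (P? : Decidable P) xs ys →
  length (filter P? (xs List.++ ys)) ≡ length (filter P? xs) ℕ.+ length (filter P? ys)
length-filter-++ P? xs ys = trans (cong length (LP.filter-++ P? xs ys)) (LP.length-++ (filter P? xs))

length-filter-map : ∀ {A B : Set} {P : B → Set} (P? : Decidable P) (f : A → B) xs →
  length (filter P? (List.map f xs)) ≡ length (filter (λ x → P? (f x)) xs)
length-filter-map P? f []       = refl
length-filter-map P? f (x ∷ xs) with P? (f x)
... | yes _ = cong suc (length-filter-map P? f xs)
... | no _  = length-filter-map P? f xs

length-filter-concatMap : ∀ {A B : Set} {P : B → Set} (P? : Decidable P) (f : A → List B) xs →
  length (filter P? (concatMap f xs)) ≡ sum (List.map (λ x → length (filter P? (f x))) xs)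
length-filter-concatMap P? f []       = refl
length-filter-concatMap P? f (x ∷ xs) = trans (length-filter-++ P? (f x) (concatMap f xs))
  (cong (length (filter P? (f x)) ℕ.+_) (length-filter-concatMap P? f xs))

length-filter-none : ∀ {A : Set} {P : A → Set} (P? : Decidable P) → (∀ x → ¬ P x) →
  ∀ xs → length (filter P? xs) ≡ 0
length-filter-none P? ¬P xs = cong length (LP.filter-none P? (All.universal ¬P xs))

length-filter-cong : ∀ {A : Set} {P Q : A → Set} (P? : Decidable P) (Q? : Decidable Q) →
  (∀ x → P x ⇔ Q x) → ∀ xs → length (filter P? xs) ≡ length (filter Q? xs)
length-filter-cong P? Q? P⇔Q xs =
  cong length (LP.filter-≐ P? Q? ((λ {x} → Equivalence.to (P⇔Q x)) , (λ {x} → Equivalence.from (P⇔Q x))) xs)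

sum-map-+ : ∀ {B : Set} (f g : B → ℕ) (J : List B) →
  sum (List.map (λ j → f j ℕ.+ g j) J) ≡ sum (List.map f J) ℕ.+ sum (List.map g J)
sum-map-+ f g []      = refl
sum-map-+ f g (j ∷ J) rewrite sum-map-+ f g J = interchange NP.+-commutativeSemigroup (f j) (g j) _ _

sum-map-*ʳ : ∀ {A : Set} (f : A → ℕ) c xs →
  sum (List.map f xs) ℕ.* c ≡ sum (List.map (λ x → f x ℕ.* c) xs)
sum-map-*ʳ f c []       = refl
sum-map-*ʳ f c (x ∷ xs) = trans (NP.*-distribʳ-+ c (f x) _) (cong (f x ℕ.* c ℕ.+_) (sum-map-*ʳ f c xs))

sum-map-zero : ∀ {B : Set} (f : B → ℕ) (J : List B) → (∀ j → j ∈ₗ J → f j ≡ 0) → sum (List.map f J) ≡ 0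
sum-map-zero f []      z = refl
sum-map-zero f (j ∷ J) z rewrite z j (here refl) = sum-map-zero f J (λ j p → z j (there p))

length-≡-by-bijection : ∀ {U Y : Set} (Φ : U → Y) {G : List U} {T : List Y} → Unique G → Unique T →
  (∀ {u u'} → u ∈ₗ G → u' ∈ₗ G → Φ u ≡ Φ u' → u ≡ u') →
  (∀ {u} → u ∈ₗ G → Φ u ∈ₗ T) → (∀ {y} → y ∈ₗ T → ∃ λ u → u ∈ₗ G × Φ u ≡ y) →
  length G ≡ length T
length-≡-by-bijection Φ {G} {T} G! T! inj into onto =
  trans (sym (LP.length-map Φ G)) (Unique-length (Unique-map Φ G! inj) T! λ y → mk⇔ (image⇒T y) (T⇒image y))
  where
  image⇒T : ∀ y → y ∈ₗ List.map Φ G → y ∈ₗ T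
  image⇒T y y∈ with MP.∈-map⁻ Φ y∈
  ... | u , u∈ , refl = into u∈
  T⇒image : ∀ y → y ∈ₗ T → y ∈ₗ List.map Φ G
  T⇒image y y∈ with onto y∈
  ... | u , u∈ , refl = MP.∈-map⁺ Φ u∈

sum-indicator-at : ∀ {B : Set} (b : B) (b≟_ : ∀ j → Dec (b ≡ j)) (f : B → ℕ) {J : List B} →
  Unique J → b ∈ₗ J → sum (List.map (λ j → if does (b≟ j) then f j else 0) J) ≡ f b
sum-indicator-at b b≟_ f {j ∷ J} (j∉ ∷ J!) b∈ with b≟ j
... | yes refl = trans (cong (f b ℕ.+_) (sum-map-zero _ J off)) (NP.+-identityʳ _)
  where
  off : ∀ j' → j' ∈ₗ J → (if does (b≟ j') then f j' else 0) ≡ 0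
  off j' j'∈ with b≟ j'
  ... | yes refl = ⊥-elim (All.lookup j∉ j'∈ refl)
  ... | no _     = refl
... | no b≢j with b∈
...   | here b≡j  = ⊥-elim (b≢j b≡j)
...   | there b∈J = sum-indicator-at b b≟_ f J! b∈J

sum-over-fibres : ∀ {A B : Set} (h : A → B) {J : List B} → Unique J → (∀ a → h a ∈ₗ J) →
  (h≟ : ∀ a j → Dec (h a ≡ j)) {P : B → A → Set} (P? : ∀ j a → Dec (P j a)) (W : List A) →
  sum (List.map (λ j → length (filter (P? j) (filter (λ a → h≟ a j) W))) J)
    ≡ length (filter (λ a → P? (h a) a) W)
sum-over-fibres h {J} J! h∈J h≟ P? []      = sum-map-zero _ J (λ _ _ → refl)
sum-over-fibres {A} {B} h {J} J! h∈J h≟ P? (a ∷ W) = begin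
  sum (List.map (λ j → length (filter (P? j) (filter (λ a → h≟ a j) (a ∷ W)))) J)
    ≡⟨ cong sum (LP.map-cong split J) ⟩
  sum (List.map (λ j → contribution j ℕ.+ length (filter (P? j) (filter (λ a → h≟ a j) W))) J)
    ≡⟨ sum-map-+ contribution _ J ⟩
  sum (List.map contribution J) ℕ.+ sum (List.map (λ j → length (filter (P? j) (filter (λ a → h≟ a j) W))) J)
    ≡⟨ cong₂ ℕ._+_ (sum-indicator-at (h a) (h≟ a) (λ j → indicator (P? j a)) J! (h∈J a))
                    (sum-over-fibres h J! h∈J h≟ P? W) ⟩
  indicator (P? (h a) a) ℕ.+ length (filter (λ a → P? (h a) a) W)
    ≡⟨ length-filter-∷ (λ a → P? (h a) a) a W ⟨
  length (filter (λ a → P? (h a) a) (a ∷ W)) ∎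
  where
  open ≡-Reasoning
  contribution : B → ℕ
  contribution j = if does (h≟ a j) then indicator (P? j a) else 0
  split : ∀ j → length (filter (P? j) (filter (λ a → h≟ a j) (a ∷ W)))
              ≡ contribution j ℕ.+ length (filter (P? j) (filter (λ a → h≟ a j) W))
  split j with h≟ a j
  ... | no _ = refl
  ... | yes _ with P? j a
  ...   | yes _ = refl
  ...   | no _  = refl
  length-filter-∷ : ∀ {Q : A → Set} (Q? : Decidable Q) x xs →
    length (filter Q? (x ∷ xs)) ≡ indicator (Q? x) ℕ.+ length (filter Q? xs)
  length-filter-∷ Q? x xs with Q? x
  ... | yes _ = refl
  ... | no _  = refl

∑-mono : ∀ {n} {f g : Fin n → ℕ} → (∀ i → f i ≤ g i) → ∑ f ≤ ∑ g
∑-mono {zero}  f≤g = z≤n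
∑-mono {suc n} f≤g = NP.+-mono-≤ (f≤g zero) (∑-mono (λ i → f≤g (suc i)))

∑-mono-< : ∀ {n} {f g : Fin n → ℕ} → (∀ i → f i ≤ g i) → ∀ a → f a < g a → ∑ f < ∑ g
∑-mono-< {suc n} f≤g zero    lt = NP.+-mono-<-≤ lt (∑-mono (λ i → f≤g (suc i)))
∑-mono-< {suc n} f≤g (suc a) lt = NP.+-mono-≤-< (f≤g zero) (∑-mono-< (λ i → f≤g (suc i)) a lt)

∑-zero : ∀ {n} (f : Fin n → ℕ) → (∀ i → f i ≡ 0) → ∑ f ≡ 0
∑-zero {zero}  f f≡0 = refl
∑-zero {suc n} f f≡0 rewrite f≡0 zero = ∑-zero (λ i → f (suc i)) (λ i → f≡0 (suc i))

∑-at : ∀ {n} (f : Fin n → ℕ) a → (∀ i → i ≢ a → f i ≡ 0) → ∑ f ≡ f a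
∑-at {suc n} f zero    off = trans (cong (f zero ℕ.+_) (∑-zero _ (λ i → off (suc i) (λ ())))) (NP.+-identityʳ _)
∑-at {suc n} f (suc a) off rewrite off zero (λ ()) =
  ∑-at (λ i → f (suc i)) a (λ i i≢a → off (suc i) (λ e → i≢a (FP.suc-injective e)))

∑-*ʳ : ∀ {n} (f : Fin n → ℕ) c → ∑ f ℕ.* c ≡ ∑ (λ i → f i ℕ.* c)
∑-*ʳ {zero}  f c = refl
∑-*ʳ {suc n} f c = trans (NP.*-distribʳ-+ c (f zero) _) (cong (f zero ℕ.* c ℕ.+_) (∑-*ʳ (λ i → f (suc i)) c))

∑-*ˡ : ∀ {n} c (f : Fin n → ℕ) → c ℕ.* ∑ f ≡ ∑ (λ i → c ℕ.* f i)
∑-*ˡ c f = trans (NP.*-comm c (∑ f)) (trans (∑-*ʳ f c) (∑-cong (λ i → NP.*-comm (f i) c)))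

count : ∀ {n} {P : Fin n → Set} → Decidable P → ℕ
count P? = ∑ (λ i → indicator (P? i))

indicator-cong : ∀ {P Q : Set} (P? : Dec P) (Q? : Dec Q) → (P ⇔ Q) → indicator P? ≡ indicator Q?
indicator-cong (yes _) (yes _) P⇔Q = refl
indicator-cong (yes p) (no ¬q) P⇔Q = ⊥-elim (¬q (Equivalence.to P⇔Q p))
indicator-cong (no ¬p) (yes q) P⇔Q = ⊥-elim (¬p (Equivalence.from P⇔Q q))
indicator-cong (no _)  (no _)  P⇔Q = refl

indicator-mono : ∀ {P Q : Set} (P? : Dec P) (Q? : Dec Q) → (P → Q) → indicator P? ≤ indicator Q?
indicator-mono (yes _) (yes _) P⇒Q = NP.≤-refl
indicator-mono (yes p) (no ¬q) P⇒Q = ⊥-elim (¬q (P⇒Q p))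
indicator-mono (no _)  Q?      P⇒Q = z≤n

count-cong : ∀ {n} {P Q : Fin n → Set} (P? : Decidable P) (Q? : Decidable Q) →
  (∀ i → P i ⇔ Q i) → count P? ≡ count Q?
count-cong P? Q? P⇔Q = ∑-cong (λ i → indicator-cong (P? i) (Q? i) (P⇔Q i))

count-mono : ∀ {n} {P Q : Fin n → Set} (P? : Decidable P) (Q? : Decidable Q) →
  (∀ i → P i → Q i) → count P? ≤ count Q?
count-mono P? Q? P⊆Q = ∑-mono (λ i → indicator-mono (P? i) (Q? i) (P⊆Q i))

count-mono-< : ∀ {n} {P Q : Fin n → Set} (P? : Decidable P) (Q? : Decidable Q) →
  (∀ i → P i → Q i) → ∀ a → Q a → ¬ P a → count P? < count Q?
count-mono-< {P = P} {Q} P? Q? P⊆Q a qa ¬pa = ∑-mono-< (λ i → indicator-mono (P? i) (Q? i) (P⊆Q i)) a (gap (P? a) (Q? a))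
  where
  gap : (pa? : Dec (P a)) (qa? : Dec (Q a)) → indicator pa? < indicator qa?
  gap (yes pa) _        = ⊥-elim (¬pa pa)
  gap (no _)   (yes _)  = s≤s z≤n
  gap (no _)   (no ¬qa) = ⊥-elim (¬qa qa)

count-⊎ : ∀ {n} {P Q R : Fin n → Set} (P? : Decidable P) (Q? : Decidable Q) (R? : Decidable R) →
  (∀ i → R i ⇔ (P i ⊎ Q i)) → (∀ i → P i → Q i → ⊥) → count R? ≡ count P? ℕ.+ count Q?
count-⊎ P? Q? R? R⇔P⊎Q disjoint =
  trans (∑-cong (λ i → split (P? i) (Q? i) (R? i) (R⇔P⊎Q i) (disjoint i)))
        (∑-distrib-+ (λ i → indicator (P? i)) (λ i → indicator (Q? i)))
  where
  split : ∀ {P Q R : Set} (p : Dec P) (q : Dec Q) (r : Dec R) → R ⇔ (P ⊎ Q) → (P → Q → ⊥) →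
    indicator r ≡ indicator p ℕ.+ indicator q
  split (yes p) (yes q) r       R⇔ d = ⊥-elim (d p q)
  split (yes p) (no _)  (yes _) R⇔ d = refl
  split (yes p) (no _)  (no ¬r) R⇔ d = ⊥-elim (¬r (Equivalence.from R⇔ (inj₁ p)))
  split (no _)  (yes q) (yes _) R⇔ d = refl
  split (no _)  (yes q) (no ¬r) R⇔ d = ⊥-elim (¬r (Equivalence.from R⇔ (inj₂ q)))
  split (no ¬p) (no ¬q) (yes r) R⇔ d with Equivalence.to R⇔ r
  ... | inj₁ p = ⊥-elim (¬p p)
  ... | inj₂ q = ⊥-elim (¬q q)
  split (no _)  (no _)  (no _)  R⇔ d = refl

count-permute : ∀ {n} {P : Fin n → Set} (P? : Decidable P) (π : Permutation′ n) →
  count P? ≡ count (λ i → P? (π ⟨$⟩ʳ i))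
count-permute P? π = sum-permute (λ i → indicator (P? i)) π

count-toℕ< : ∀ {n} (L : ℕ) → L ≤ n → count {n} (λ i → toℕ i ℕ.<? L) ≡ L
count-toℕ< {zero}  zero    z≤n       = refl
count-toℕ< {suc n} zero    z≤n       = ∑-zero {suc n} _ (λ i → refl)
count-toℕ< {suc n} (suc L) (s≤s L≤n) = cong suc (trans
  (∑-cong {n} (λ i → indicator-cong (toℕ (suc i) ℕ.<? suc L) (toℕ i ℕ.<? L) (mk⇔ NP.≤-pred s≤s)))
  (count-toℕ< {n} L L≤n))

count≤n : ∀ {n} {P : Fin n → Set} (P? : Decidable P) → count P? ≤ n
count≤n {n} P? = subst (count P? ≤_) (count-toℕ< {n} n NP.≤-refl)
  (count-mono P? (λ i → toℕ i ℕ.<? n) (λ i _ → FP.toℕ<n i))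

count-≡ : ∀ {n} (a : Fin n) → count (λ i → i Fin.≟ a) ≡ 1
count-≡ a = trans (∑-at (λ i → indicator (i Fin.≟ a)) a off) (on (a Fin.≟ a))
  where
  off : ∀ i → i ≢ a → indicator (i Fin.≟ a) ≡ 0
  off i i≢a with i Fin.≟ a
  ... | yes i≡a = ⊥-elim (i≢a i≡a)
  ... | no _    = refl
  on : (d : Dec (a ≡ a)) → indicator d ≡ 1
  on (yes _) = refl
  on (no a≢a) = ⊥-elim (a≢a refl)

<-chain : ∀ {n} (Q : Fin n → Fin n → Set) → (∀ {a b c} → Q a b → Q b c → Q a c) →
  (∀ a b → suc (toℕ a) ≡ toℕ b → Q a b) → ∀ a b → toℕ a < toℕ b → Q a b
<-chain {n} Q trans-Q step a b a<b = go (toℕ b ℕ.∸ suc (toℕ a)) b (sym (NP.m∸n+n≡m a<b))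
  where
  go : ∀ d b → toℕ b ≡ d ℕ.+ suc (toℕ a) → Q a b
  go zero    b b≡ = step a b (sym b≡)
  go (suc d) b b≡ = trans-Q (go d c (FP.toℕ-fromℕ< c<n)) (step c b (trans (cong suc (FP.toℕ-fromℕ< c<n)) (sym b≡)))
    where
    c<n : d ℕ.+ suc (toℕ a) < n
    c<n = NP.<-≤-trans (subst (d ℕ.+ suc (toℕ a) <_) (sym b≡) (NP.n<1+n _)) (FP.toℕ≤n b)
    c : Fin n
    c = fromℕ< c<n

-- (false , 0) is a junk value: it is only ever read at positions below the length.
nth : List Card → ℕ → Card
nth []       t       = (false , 0)
nth (x ∷ xs) zero    = x
nth (x ∷ xs) (suc t) = nth xs t

nth-++ˡ : ∀ xs ys t → t < length xs → nth (xs ++ ys) t ≡ nth xs t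
nth-++ˡ (x ∷ xs) ys zero    _         = refl
nth-++ˡ (x ∷ xs) ys (suc t) (s≤s t<l) = nth-++ˡ xs ys t t<l

nth-++-length : ∀ xs ys → nth (xs ++ ys) (length xs) ≡ nth ys 0
nth-++-length []       ys = refl
nth-++-length (x ∷ xs) ys = nth-++-length xs ys

nth-reverse : ∀ s t → t < length s → nth (reverse s) t ≡ nth s (length s ∸ suc t)
nth-reverse (x ∷ s) t t<l rewrite LP.unfold-reverse x s with NP.m≤n⇒m<n∨m≡n (NP.≤-pred t<l)
... | inj₁ t<s = begin
  nth (reverse s ++ x ∷ []) t ≡⟨ nth-++ˡ (reverse s) _ t (subst (t <_) (sym (LP.length-reverse s)) t<s) ⟩
  nth (reverse s) t           ≡⟨ nth-reverse s t t<s ⟩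
  nth s (length s ∸ suc t)    ≡⟨ cong (nth (x ∷ s)) (NP.+-∸-assoc 1 t<s) ⟨
  nth (x ∷ s) (length s ∸ t)  ∎
  where open ≡-Reasoning
... | inj₂ refl = trans
  (subst (λ z → nth (reverse s ++ x ∷ []) z ≡ x) (LP.length-reverse s) (nth-++-length (reverse s) (x ∷ [])))
  (cong (nth (x ∷ s)) (sym (NP.n∸n≡0 (length s))))

nth-map : ∀ (f : Card → Card) s t → t < length s → nth (List.map f s) t ≡ f (nth s t)
nth-map f (x ∷ s) zero    _         = refl
nth-map f (x ∷ s) (suc t) (s≤s t<l) = nth-map f s t t<l

nth-take : ∀ a xs t → t < a → nth (take a xs) t ≡ nth xs t
nth-take (suc a) []       t       _         = refl
nth-take (suc a) (x ∷ xs) zero    _         = refl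
nth-take (suc a) (x ∷ xs) (suc t) (s≤s t<a) = nth-take a xs t t<a

nth-drop : ∀ b xs t → nth (drop b xs) t ≡ nth xs (b ℕ.+ t)
nth-drop zero    xs       t = refl
nth-drop (suc b) []       t = refl
nth-drop (suc b) (x ∷ xs) t = nth-drop b xs t

nth-applyUpTo : ∀ (g : ℕ → Card) n t → t < n → nth (applyUpTo g n) t ≡ g t
nth-applyUpTo g (suc n) zero    _         = refl
nth-applyUpTo g (suc n) (suc t) (s≤s t<n) = nth-applyUpTo (λ x → g (suc x)) n t t<n

nth-initialDeck : ∀ n t → t < n → nth (initialDeck n) t ≡ (false , suc t)
nth-initialDeck n t t<n =
  trans (cong (λ d → nth d t) (LP.map-upTo (λ l → (false , suc l)) n)) (nth-applyUpTo _ n t t<n)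

length-initialDeck : ∀ n → length (initialDeck n) ≡ n
length-initialDeck n = trans (LP.length-map _ (List.upTo n)) (LP.length-upTo n)

offset : ∀ {k} → Vec ℕ k → Fin k → ℕ
offset (x ∷ js) zero    = 0
offset (x ∷ js) (suc r) = x ℕ.+ offset js r

lookup-cut : ∀ {A : Set} {k} (j : Vec ℕ k) (xs : List A) r →
  lookup (cut j xs) r ≡ take (lookup j r) (drop (offset j r) xs)
lookup-cut (x ∷ j) xs zero    = refl
lookup-cut (x ∷ j) xs (suc r) =
  trans (lookup-cut j (drop x xs) r) (cong (take (lookup j r)) (LP.drop-drop x (offset j r) xs))

block : ℕ → ℕ → ℕ → List Card
block n J a = take a (drop J (initialDeck n))

length-block : ∀ n J a → J ℕ.+ a ≤ n → length (block n J a) ≡ a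
length-block n J a J+a≤n = begin
  length (take a (drop J (initialDeck n))) ≡⟨ LP.length-take a _ ⟩
  a ℕ.⊓ length (drop J (initialDeck n))    ≡⟨ cong (a ℕ.⊓_) (LP.length-drop J (initialDeck n)) ⟩
  a ℕ.⊓ (length (initialDeck n) ∸ J)       ≡⟨ cong (λ l → a ℕ.⊓ (l ∸ J)) (length-initialDeck n) ⟩
  a ℕ.⊓ (n ∸ J)                            ≡⟨ NP.m≤n⇒m⊓n≡m (subst (_≤ n ∸ J) (NP.m+n∸m≡n J a) (NP.∸-monoˡ-≤ J J+a≤n)) ⟩
  a                                        ∎
  where open ≡-Reasoning

nth-block : ∀ n J a t → J ℕ.+ a ≤ n → t < a → nth (block n J a) t ≡ (false , suc (J ℕ.+ t))
nth-block n J a t J+a≤n t<a = trans (nth-take a _ t t<a)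
  (trans (nth-drop J _ t) (nth-initialDeck n (J ℕ.+ t) (NP.<-≤-trans (NP.+-monoʳ-< J t<a) J+a≤n)))

-- The card at depth t of stack r, when that stack was cut from the cards J+1, …, J+a.
stackCard : (k : ℕ) → Fin k → (J a t : ℕ) → Card
stackCard k r J a t =
  if flipped k (suc (toℕ r)) then (true , suc (J ℕ.+ (a ∸ suc t))) else (false , suc (J ℕ.+ t))

stack-contents : ∀ n {k} (j : Vec ℕ k) r → offset j r ℕ.+ lookup j r ≤ n →
  (length (lookup (stacks n j) r) ≡ lookup j r) ×
  (∀ t → t < lookup j r → nth (lookup (stacks n j) r) t ≡ stackCard k r (offset j r) (lookup j r) t)
stack-contents n {k} j r fits
  rewrite VP.lookup∘tabulate (λ r → let s = lookup (cut j (initialDeck n)) r in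
                                    if flipped k (suc (toℕ r)) then turnOver s else s) r
        | lookup-cut j (initialDeck n) r
  with flipped k (suc (toℕ r))
... | false = length-block n (offset j r) (lookup j r) fits , λ t → nth-block n (offset j r) (lookup j r) t fits
... | true  = trans (LP.length-map _ (reverse B)) (trans (LP.length-reverse B) |B|) , nth-turnOver
  where
  B : List Card
  B = block n (offset j r) (lookup j r)
  |B| : length B ≡ lookup j r
  |B| = length-block n (offset j r) (lookup j r) fits
  nth-turnOver : ∀ t → t < lookup j r → nth (turnOver B) t ≡ (true , suc (offset j r ℕ.+ (lookup j r ∸ suc t)))
  nth-turnOver t t<a = begin
    nth (turnOver B) t
      ≡⟨ nth-map _ (reverse B) t (subst (t <_) (sym (trans (LP.length-reverse B) |B|)) t<a) ⟩
    turn (nth (reverse B) t)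
      ≡⟨ cong turn (nth-reverse B t (subst (t <_) (sym |B|) t<a)) ⟩
    turn (nth B (length B ∸ suc t))
      ≡⟨ cong (λ l → turn (nth B (l ∸ suc t))) |B| ⟩
    turn (nth B (lookup j r ∸ suc t))
      ≡⟨ cong turn (nth-block n (offset j r) (lookup j r) _ fits (NP.∸-monoʳ-< {o = 0} (s≤s z≤n) t<a)) ⟩
    (true , suc (offset j r ℕ.+ (lookup j r ∸ suc t))) ∎
    where
    open ≡-Reasoning
    turn : Card → Card
    turn c = (not (proj₁ c) , proj₂ c)

module _ {k : ℕ} where

  -- the depth, in its stack, of the card placed at position i
  rank : ∀ {n} → Vec (Fin k) n → Fin n → ℕ
  rank (x ∷ u) zero    = 0
  rank (x ∷ u) (suc i) = indicator (lookup u i Fin.≟ x) ℕ.+ rank u i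

  private
    count-∷-≡ : ∀ {n} x (u : Vec (Fin k) n) → Vec.count (x Fin.≟_) (x ∷ u) ≡ suc (Vec.count (x Fin.≟_) u)
    count-∷-≡ x u with x Fin.≟ x
    ... | yes _   = refl
    ... | no x≢x  = ⊥-elim (x≢x refl)

    count-∷-≢ : ∀ {n} r x (u : Vec (Fin k) n) → r ≢ x → Vec.count (r Fin.≟_) (x ∷ u) ≡ Vec.count (r Fin.≟_) u
    count-∷-≢ r x u r≢x with r Fin.≟ x
    ... | yes r≡x = ⊥-elim (r≢x r≡x)
    ... | no _    = refl

  interleave-tabulate : ∀ {n} (u : Vec (Fin k) n) (st : Vec (List Card) k) →
    (∀ r → Vec.count (r Fin.≟_) u ≤ length (lookup st r)) →
    interleave (Vec.toList u) st ≡ List.tabulate (λ i → nth (lookup st (lookup u i)) (rank u i))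
  interleave-tabulate []      st enough = refl
  interleave-tabulate (x ∷ u) st enough with lookup st x in st[x]
  ... | [] = ⊥-elim (NP.≤⇒≯ (subst₂ _≤_ (count-∷-≡ x u) (cong length st[x]) (enough x)) (s≤s z≤n))
  ... | c ∷ cs = cong (c ∷_) (trans (interleave-tabulate u st′ enough′) (LP.tabulate-cong popped))
    where
    st′ : Vec (List Card) k
    st′ = st [ x ]≔ cs
    enough′ : ∀ r → Vec.count (r Fin.≟_) u ≤ length (lookup st′ r)
    enough′ r with r Fin.≟ x
    ... | yes refl = subst (Vec.count (x Fin.≟_) u ≤_) (sym (cong length (VP.lookup∘update x st cs)))
                       (NP.≤-pred (subst₂ _≤_ (count-∷-≡ x u) (cong length st[x]) (enough x)))
    ... | no r≢x   = subst₂ _≤_ (count-∷-≢ r x u r≢x) (cong length (sym (VP.lookup∘update′ r≢x st cs))) (enough r)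
    popped : ∀ i → nth (lookup st′ (lookup u i)) (rank u i)
                 ≡ nth (lookup st (lookup u i)) (indicator (lookup u i Fin.≟ x) ℕ.+ rank u i)
    popped i with lookup u i Fin.≟ x
    ... | yes refl rewrite st[x] = cong (λ s → nth s (rank u i)) (VP.lookup∘update x st cs)
    ... | no ui≢x  = cong (λ s → nth s (rank u i)) (VP.lookup∘update′ ui≢x st cs)

  Vec-count≡count : ∀ {n} (r : Fin k) (u : Vec (Fin k) n) → Vec.count (r Fin.≟_) u ≡ count (λ i → r Fin.≟ lookup u i)
  Vec-count≡count r []      = refl
  Vec-count≡count r (x ∷ u) with r Fin.≟ x
  ... | yes _ = cong suc (Vec-count≡count r u)
  ... | no _  = Vec-count≡count r u

  lookup-counts : ∀ {n} (u : Vec (Fin k) n) r → lookup (counts u) r ≡ count (λ i → r Fin.≟ lookup u i)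
  lookup-counts u r = trans (VP.lookup∘tabulate _ r) (Vec-count≡count r u)

  rank≡count : ∀ {n} (u : Vec (Fin k) n) i →
    rank u i ≡ count (λ i' → (toℕ i' ℕ.<? toℕ i) ×-dec (lookup u i' Fin.≟ lookup u i))
  rank≡count {suc n} (x ∷ u) zero =
    sym (∑-zero (λ i' → indicator ((toℕ i' ℕ.<? 0) ×-dec (lookup (x ∷ u) i' Fin.≟ x))) (λ { zero → refl ; (suc i) → refl }))
  rank≡count {suc n} (x ∷ u) (suc i) = cong₂ ℕ._+_
    (indicator-cong (lookup u i Fin.≟ x) ((0 ℕ.<? suc (toℕ i)) ×-dec (x Fin.≟ lookup u i))
      (mk⇔ (λ e → s≤s z≤n , sym e) (λ p → sym (proj₂ p))))
    (trans (rank≡count u i) (∑-cong {n} λ i' →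
      indicator-cong ((toℕ i' ℕ.<? toℕ i) ×-dec (lookup u i' Fin.≟ lookup u i))
                     ((suc (toℕ i') ℕ.<? suc (toℕ i)) ×-dec (lookup u i' Fin.≟ lookup u i))
                     (mk⇔ (λ { (a , b) → s≤s a , b }) (λ { (s≤s a , b) → a , b }))))

  offset-counts : ∀ {n} (u : Vec (Fin k) n) r → offset (counts u) r ≡ count (λ i → toℕ (lookup u i) ℕ.<? toℕ r)
  offset-counts {n} u r = begin
    offset (counts u) r
      ≡⟨ offset-tabulate _ r ⟩
    ∑ (λ r' → below r' ℕ.* Vec.count (r' Fin.≟_) u)
      ≡⟨ ∑-cong (λ r' → trans (cong (below r' ℕ.*_) (Vec-count≡count r' u)) (∑-*ˡ {n} (below r') _)) ⟩
    ∑ (λ r' → ∑ (λ i → below r' ℕ.* indicator (r' Fin.≟ lookup u i)))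
      ≡⟨ ∑-comm (λ r' i → below r' ℕ.* indicator (r' Fin.≟ lookup u i)) ⟩
    ∑ (λ i → ∑ (λ r' → below r' ℕ.* indicator (r' Fin.≟ lookup u i)))
      ≡⟨ ∑-cong (λ i → trans (∑-at _ (lookup u i) (off i)) (on i)) ⟩
    count (λ i → toℕ (lookup u i) ℕ.<? toℕ r) ∎
    where
    open ≡-Reasoning
    below : Fin k → ℕ
    below r' = indicator (toℕ r' ℕ.<? toℕ r)
    offset-tabulate : ∀ {k} (f : Fin k → ℕ) (r : Fin k) →
      offset (Vec.tabulate f) r ≡ ∑ (λ r' → indicator (toℕ r' ℕ.<? toℕ r) ℕ.* f r')
    offset-tabulate {suc k} f zero =
      sym (∑-zero (λ r' → indicator (toℕ r' ℕ.<? 0) ℕ.* f r') (λ { zero → refl ; (suc i) → refl }))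
    offset-tabulate f (suc r) = cong₂ ℕ._+_ (sym (NP.+-identityʳ (f zero))) (offset-tabulate (λ i → f (suc i)) r)
    off : ∀ i r' → r' ≢ lookup u i → below r' ℕ.* indicator (r' Fin.≟ lookup u i) ≡ 0
    off i r' r'≢ with r' Fin.≟ lookup u i
    ... | yes r'≡ = ⊥-elim (r'≢ r'≡)
    ... | no _    = NP.*-zeroʳ (below r')
    on : ∀ i → below (lookup u i) ℕ.* indicator (lookup u i Fin.≟ lookup u i) ≡ below (lookup u i)
    on i with lookup u i Fin.≟ lookup u i
    ... | yes _ = NP.*-identityʳ (below (lookup u i))
    ... | no ≢  = ⊥-elim (≢ refl)

  count-≤⊎≡ : ∀ {n} (u : Vec (Fin k) n) r →
    count (λ i → toℕ (lookup u i) ℕ.≤? toℕ r)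
      ≡ count (λ i → toℕ (lookup u i) ℕ.<? toℕ r) ℕ.+ count (λ i → r Fin.≟ lookup u i)
  count-≤⊎≡ u r = count-⊎ (λ i → toℕ (lookup u i) ℕ.<? toℕ r) (λ i → r Fin.≟ lookup u i)
                          (λ i → toℕ (lookup u i) ℕ.≤? toℕ r)
    (λ i → mk⇔ split (λ { (inj₁ lt) → NP.<⇒≤ lt ; (inj₂ e) → NP.≤-reflexive (cong toℕ (sym e)) }))
    (λ i lt e → NP.<-irrefl (cong toℕ (sym e)) lt)
    where
    split : ∀ {i} → toℕ (lookup u i) ≤ toℕ r → toℕ (lookup u i) < toℕ r ⊎ r ≡ lookup u i
    split le with NP.m≤n⇒m<n∨m≡n le
    ... | inj₁ lt = inj₁ lt
    ... | inj₂ e  = inj₂ (sym (FP.toℕ-injective e))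

  offset+count≤n : ∀ {n} (u : Vec (Fin k) n) r → offset (counts u) r ℕ.+ lookup (counts u) r ≤ n
  offset+count≤n u r rewrite offset-counts u r | lookup-counts u r | sym (count-≤⊎≡ u r) =
    count≤n (λ i → toℕ (lookup u i) ℕ.≤? toℕ r)

  rank<count : ∀ {n} (u : Vec (Fin k) n) i → rank u i < lookup (counts u) (lookup u i)
  rank<count u i rewrite rank≡count u i | lookup-counts u (lookup u i) =
    count-mono-< (λ i' → (toℕ i' ℕ.<? toℕ i) ×-dec (lookup u i' Fin.≟ lookup u i)) (λ i' → lookup u i Fin.≟ lookup u i')
      (λ i' p → sym (proj₂ p)) i refl (λ p → NP.<-irrefl refl (proj₁ p))

tabulate-injective : ∀ {A : Set} {n} (f g : Fin n → A) → List.tabulate f ≡ List.tabulate g → ∀ i → f i ≡ g i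
tabulate-injective {n = suc n} f g eq zero    = LP.∷-injectiveˡ eq
tabulate-injective {n = suc n} f g eq (suc i) =
  tabulate-injective (λ i → f (suc i)) (λ i → g (suc i)) (LP.∷-injectiveʳ eq) i

-- Labels are 0-based: the card labelled l + 1 lies at position (position l).
module Labelling {n} (σ : SignedPerm n) where

  position : Fin n → Fin n
  position l = π σ ⟨$⟩ˡ l

  label : Fin n → Fin n
  label i = π σ ⟨$⟩ʳ i

  faceUp : Fin n → Bool
  faceUp l = neg σ (position l)

  label-position : ∀ l → label (position l) ≡ l
  label-position l = Perm.inverseʳ (π σ)

  position-label : ∀ i → position (label i) ≡ i
  position-label i = Perm.inverseˡ (π σ)

module Outcome (n k : ℕ) (σ : SignedPerm n) where

  target : Fin n → Card
  target i = (neg σ i , suc (toℕ (π σ ⟨$⟩ʳ i)))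

  -- The word u (read top to bottom) fixes both the cut (its letter counts) and the interleaving.
  Produces : Vec (Fin k) n → Set
  Produces u = interleave (Vec.toList u) (stacks n (counts u)) ≡ encode σ

  placed : Vec (Fin k) n → Fin n → Card
  placed u i = stackCard k (lookup u i) (offset (counts u) (lookup u i)) (lookup (counts u) (lookup u i)) (rank u i)

  interleave-counts : ∀ u → interleave (Vec.toList u) (stacks n (counts u)) ≡ List.tabulate (placed u)
  interleave-counts u = trans (interleave-tabulate u (stacks n (counts u)) enough)
    (LP.tabulate-cong (λ i → proj₂ (stack-contents n (counts u) (lookup u i) (offset+count≤n u (lookup u i))) (rank u i) (rank<count u i)))
    where
    enough : ∀ r → Vec.count (r Fin.≟_) u ≤ length (lookup (stacks n (counts u)) r)
    enough r = NP.≤-reflexive (sym (trans (proj₁ (stack-contents n (counts u) r (offset+count≤n u r))) (VP.lookup∘tabulate _ r)))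

  Produces⇔ : ∀ u → Produces u ⇔ (∀ i → target i ≡ placed u i)
  Produces⇔ u = mk⇔
    (λ eq i → sym (tabulate-injective (placed u) target (trans (sym (interleave-counts u)) (trans eq encode-tabulate)) i))
    (λ eq → trans (interleave-counts u) (trans (LP.tabulate-cong (λ i → sym (eq i))) (sym encode-tabulate)))
    where
    encode-tabulate : encode σ ≡ List.tabulate target
    encode-tabulate = LP.map-tabulate (λ i → i) target

∸-<⇒> : ∀ {m a b} → m ∸ a < m ∸ b → b < a
∸-<⇒> {m} lt = NP.≰⇒> (λ a≤b → NP.<⇒≱ lt (NP.∸-monoʳ-≤ m a≤b))

isEven-suc : ∀ n → isEven (suc n) ≡ not (isEven n)
isEven-suc zero    = refl
isEven-suc (suc n) rewrite isEven-suc n with isEven n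
... | true  = refl
... | false = refl

odd : ℕ → Bool
odd x = not (isEven x)

true≢false : true ≢ false
true≢false ()

flipped≡odd : ∀ k s → s ≤ k → flipped k s ≡ odd (k ∸ s)
flipped≡odd k zero _ with isEven k
... | true  = refl
... | false = refl
flipped≡odd (suc k) (suc s) (s≤s s≤k) = trans shift (flipped≡odd k s s≤k)
  where
  shift : flipped (suc k) (suc s) ≡ flipped k s
  shift rewrite isEven-suc k | isEven-suc s with isEven k | isEven s
  ... | true  | true  = refl
  ... | true  | false = refl
  ... | false | true  = refl
  ... | false | false = refl

Ordered : Bool → ℕ → ℕ → Set
Ordered false a b = a < b
Ordered true  a b = b < a

Ordered? : ∀ s a b → Dec (Ordered s a b)
Ordered? false a b = a ℕ.<? b
Ordered? true  a b = b ℕ.<? a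

Ordered-trans : ∀ s {a b c} → Ordered s a b → Ordered s b c → Ordered s a c
Ordered-trans false a<b b<c = NP.<-trans a<b b<c
Ordered-trans true  a>b b>c = NP.<-trans b>c a>b

Ordered-connex : ∀ s a b → a ≢ b → Ordered s a b ⊎ Ordered s b a
Ordered-connex s a b a≢b with NP.<-cmp a b | s
... | tri< a<b _ _ | false = inj₁ a<b
... | tri< a<b _ _ | true  = inj₂ a<b
... | tri≈ _ a≡b _ | _     = ⊥-elim (a≢b a≡b)
... | tri> _ _ a>b | false = inj₂ a>b
... | tri> _ _ a>b | true  = inj₁ a>b

-- Height functions

module Heights (n k' : ℕ) (σ : SignedPerm n) where

  k : ℕ
  k = suc k'

  open Outcome n k σ public

  open Labelling σ public

  record Admissible (g : Fin n → ℕ) : Set where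
    field
      bounded : ∀ l → g l ≤ k'
      parity  : ∀ l → odd (g l) ≡ faceUp l
      step    : ∀ l l' → suc (toℕ l) ≡ toℕ l' →
                g l' < g l ⊎ (g l ≡ g l' × Ordered (faceUp l) (toℕ (position l)) (toℕ (position l')))

  flippedStack : Fin k → Bool
  flippedStack r = flipped k (suc (toℕ r))

  labelIn : Vec (Fin k) n → Fin k → ℕ → ℕ
  labelIn u r t = if flippedStack r then offset (counts u) r ℕ.+ (lookup (counts u) r ∸ suc t)
                  else offset (counts u) r ℕ.+ t

  placedLabel : Vec (Fin k) n → Fin n → ℕ
  placedLabel u i = labelIn u (lookup u i) (rank u i)

  target≡placed⇔ : ∀ u i → target i ≡ placed u i ⇔ (neg σ i ≡ flippedStack (lookup u i) × toℕ (label i) ≡ placedLabel u i)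
  target≡placed⇔ u i with flippedStack (lookup u i)
  ... | true  = mk⇔ (λ e → cong proj₁ e , NP.suc-injective (cong proj₂ e)) (λ (e₁ , e₂) → cong₂ _,_ e₁ (cong suc e₂))
  ... | false = mk⇔ (λ e → cong proj₁ e , NP.suc-injective (cong proj₂ e)) (λ (e₁ , e₂) → cong₂ _,_ e₁ (cong suc e₂))

  offset-mono : ∀ (u : Vec (Fin k) n) r r' → toℕ r < toℕ r' →
    offset (counts u) r ℕ.+ lookup (counts u) r ≤ offset (counts u) r'
  offset-mono u r r' r<r' rewrite offset-counts u r | lookup-counts u r | offset-counts u r' | sym (count-≤⊎≡ u r) =
    count-mono (λ i → toℕ (lookup u i) ℕ.≤? toℕ r) (λ i → toℕ (lookup u i) ℕ.<? toℕ r') (λ i ≤r → NP.≤-<-trans ≤r r<r')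

  placedLabel-range : ∀ (u : Vec (Fin k) n) i → let r = lookup u i in
    offset (counts u) r ≤ placedLabel u i × placedLabel u i < offset (counts u) r ℕ.+ lookup (counts u) r
  placedLabel-range u i with flippedStack (lookup u i) | rank<count u i
  ... | true  | lt = NP.m≤m+n _ _ , NP.+-monoʳ-< (offset (counts u) (lookup u i)) (NP.∸-monoʳ-< {o = 0} (s≤s z≤n) lt)
  ... | false | lt = NP.m≤m+n _ _ , NP.+-monoʳ-< (offset (counts u) (lookup u i)) lt

  rank-mono : ∀ (u : Vec (Fin k) n) p p' → lookup u p ≡ lookup u p' → toℕ p' ≤ toℕ p → rank u p' ≤ rank u p
  rank-mono u p p' same p'≤p rewrite rank≡count u p | rank≡count u p' =
    count-mono (λ i → (toℕ i ℕ.<? toℕ p') ×-dec (lookup u i Fin.≟ lookup u p'))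
               (λ i → (toℕ i ℕ.<? toℕ p) ×-dec (lookup u i Fin.≟ lookup u p))
               (λ i (i<p' , e) → NP.<-≤-trans i<p' p'≤p , trans e (sym same))

  rank-<⇒< : ∀ (u : Vec (Fin k) n) p p' → lookup u p ≡ lookup u p' → rank u p < rank u p' → toℕ p < toℕ p'
  rank-<⇒< u p p' same lt with NP.<-cmp (toℕ p) (toℕ p')
  ... | tri< p<p' _ _ = p<p'
  ... | tri≈ _ p≡p' _ = ⊥-elim (NP.<-irrefl (cong (rank u) (FP.toℕ-injective p≡p')) lt)
  ... | tri> _ _ p>p' = ⊥-elim (NP.<⇒≱ lt (rank-mono u p p' same (NP.<⇒≤ p>p')))

  labelIn-suc : ∀ u r t t' → suc (labelIn u r t) ≡ labelIn u r t' → Ordered (flippedStack r) t t'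
  labelIn-suc u r t t' next with flippedStack r
  ... | false = NP.+-cancelˡ-< (offset (counts u) r) t t' (NP.≤-reflexive next)
  ... | true  = NP.≤-pred (∸-<⇒> {lookup (counts u) r} {suc t} {suc t'}
                  (NP.+-cancelˡ-< (offset (counts u) r) _ _ (NP.≤-reflexive next)))

  consecutive-Ordered : ∀ (u : Vec (Fin k) n) p p' → lookup u p ≡ lookup u p' →
    suc (placedLabel u p) ≡ placedLabel u p' → Ordered (flippedStack (lookup u p)) (toℕ p) (toℕ p')
  consecutive-Ordered u p p' same next with labelIn-suc u (lookup u p) (rank u p) (rank u p')
    (trans next (cong (λ r → labelIn u r (rank u p')) (sym same)))
  ... | ordered with flippedStack (lookup u p)
  ...   | false = rank-<⇒< u p p' same ordered
  ...   | true  = rank-<⇒< u p' p (sym same) ordered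

  toℕ≤k' : (r : Fin k) → toℕ r ≤ k'
  toℕ≤k' r = NP.≤-pred (FP.toℕ<n r)

  -- The stacks are numbered from the top; a card's height is the number of stacks below its own.
  heights : Vec (Fin k) n → Fin n → ℕ
  heights u l = k' ∸ toℕ (lookup u (position l))

  heights-Admissible : ∀ u → (∀ i → target i ≡ placed u i) → Admissible (heights u)
  heights-Admissible u produces = record
    { bounded = λ l → NP.m∸n≤m k' (toℕ (lookup u (position l)))
    ; parity  = λ l → trans (sym (flipped≡odd k (suc (toℕ (lookup u (position l)))) (s≤s (toℕ≤k' _)))) (sym (sign (position l)))
    ; step    = step
    }
    where
    sign : ∀ i → neg σ i ≡ flippedStack (lookup u i)
    sign i = proj₁ (Equivalence.to (target≡placed⇔ u i) (produces i))
    labelled : ∀ l → toℕ l ≡ placedLabel u (position l)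
    labelled l = trans (cong toℕ (sym (label-position l))) (proj₂ (Equivalence.to (target≡placed⇔ u (position l)) (produces (position l))))
    step : ∀ l l' → suc (toℕ l) ≡ toℕ l' →
      heights u l' < heights u l ⊎ (heights u l ≡ heights u l' × Ordered (faceUp l) (toℕ (position l)) (toℕ (position l')))
    step l l' next with NP.<-cmp (toℕ (lookup u (position l))) (toℕ (lookup u (position l')))
    ... | tri< r<r' _ _ = inj₁ (NP.∸-monoʳ-< r<r' (toℕ≤k' _))
    ... | tri≈ _ r≡r' _ = inj₂ (cong (k' ∸_) r≡r' ,
        subst (λ s → Ordered s (toℕ (position l)) (toℕ (position l'))) (sym (sign (position l)))
        (consecutive-Ordered u (position l) (position l') (FP.toℕ-injective r≡r')
          (trans (cong suc (sym (labelled l))) (trans next (labelled l')))))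
    ... | tri> _ _ r>r' = ⊥-elim (NP.<-asym labels-increase labels-decrease)
      where
      labels-increase : placedLabel u (position l) < placedLabel u (position l')
      labels-increase = NP.≤-reflexive (trans (cong suc (sym (labelled l))) (trans next (labelled l')))
      labels-decrease : placedLabel u (position l') < placedLabel u (position l)
      labels-decrease = NP.<-≤-trans (proj₂ (placedLabel-range u (position l')))
        (NP.≤-trans (offset-mono u _ _ r>r') (proj₁ (placedLabel-range u (position l))))

  heights-injective : ∀ u u' → (∀ l → heights u l ≡ heights u' l) → u ≡ u'
  heights-injective u u' same = Pointwise-≡⇒≡ (ext λ i → FP.toℕ-injective (NP.∸-cancelˡ-≡ (toℕ≤k' _) (toℕ≤k' _)
    (subst (λ p → k' ∸ toℕ (lookup u p) ≡ k' ∸ toℕ (lookup u' p)) (position-label i) (same (label i)))))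

module FromHeights (n k' : ℕ) (σ : SignedPerm n) (g : Fin n → ℕ) (adm : Heights.Admissible n k' σ g) where

  open Heights n k' σ
  open Admissible adm

  private
    -- the chained form of the step condition
    Q : Fin n → Fin n → Set
    Q a b = g b ≤ g a × (g a ≡ g b → Ordered (odd (g a)) (toℕ (position a)) (toℕ (position b)))

    Q-trans : ∀ {a b c} → Q a b → Q b c → Q a c
    Q-trans {a} {b} {c} (b≤a , ord-ab) (c≤b , ord-bc) = NP.≤-trans c≤b b≤a , λ a≡c →
      let a≡b = NP.≤-antisym (subst (_≤ g b) (sym a≡c) c≤b) b≤a in
      Ordered-trans (odd (g a)) (ord-ab a≡b)
        (subst (λ x → Ordered (odd x) (toℕ (position b)) (toℕ (position c))) (sym a≡b) (ord-bc (trans (sym a≡b) a≡c)))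

    Q-step : ∀ a b → suc (toℕ a) ≡ toℕ b → Q a b
    Q-step a b next with step a b next
    ... | inj₁ b<a         = NP.<⇒≤ b<a , λ a≡b → ⊥-elim (NP.<-irrefl (sym a≡b) b<a)
    ... | inj₂ (a≡b , ord) = NP.≤-reflexive (sym a≡b) , λ _ → subst (λ s → Ordered s _ _) (sym (parity a)) ord

  antitone : ∀ a b → toℕ a ≤ toℕ b → g b ≤ g a
  antitone a b a≤b with NP.m≤n⇒m<n∨m≡n a≤b
  ... | inj₁ a<b = proj₁ (<-chain Q Q-trans Q-step a b a<b)
  ... | inj₂ a≡b = NP.≤-reflexive (cong g (sym (FP.toℕ-injective a≡b)))

  level-order : ∀ a b → g a ≡ g b →
    toℕ (position a) < toℕ (position b) ⇔ Ordered (odd (g b)) (toℕ a) (toℕ b)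
  level-order a b a≡b = mk⇔ ⇒ (⇐ a b a≡b)
    where
    ⇐ : ∀ a b → g a ≡ g b → Ordered (odd (g b)) (toℕ a) (toℕ b) → toℕ (position a) < toℕ (position b)
    ⇐ a b a≡b ord with odd (g b) in odd-b
    ... | false = subst (λ s → Ordered s _ _) (trans (cong odd a≡b) odd-b)
                    (proj₂ (<-chain Q Q-trans Q-step a b ord) a≡b)
    ... | true  = subst (λ s → Ordered s _ _) odd-b (proj₂ (<-chain Q Q-trans Q-step b a ord) (sym a≡b))
    ⇒ : toℕ (position a) < toℕ (position b) → Ordered (odd (g b)) (toℕ a) (toℕ b)
    ⇒ pa<pb with Ordered-connex (odd (g b)) (toℕ a) (toℕ b)
                   (λ e → NP.<-irrefl (cong (λ l → toℕ (position l)) (FP.toℕ-injective e)) pa<pb)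
    ... | inj₁ ord = ord
    ... | inj₂ ord = ⊥-elim (NP.<-asym pa<pb (⇐ b a (sym a≡b) (subst (λ x → Ordered (odd x) _ _) (sym a≡b) ord)))

  word : Vec (Fin k) n
  word = Vec.tabulate (λ i → fromℕ< (s≤s (NP.m∸n≤m k' (g (label i)))))

  toℕ-word : ∀ i → toℕ (lookup word i) ≡ k' ∸ g (label i)
  toℕ-word i = trans (cong toℕ (VP.lookup∘tabulate _ i)) (FP.toℕ-fromℕ< _)

  heights-word : ∀ l → heights word l ≡ g l
  heights-word l = trans (cong (k' ∸_) (toℕ-word (position l)))
    (trans (NP.m∸[m∸n]≡n (bounded _)) (cong g (label-position l)))

  word≡⇔ : ∀ i i' → lookup word i ≡ lookup word i' ⇔ g (label i) ≡ g (label i')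
  word≡⇔ i i' = mk⇔
    (λ e → NP.∸-cancelˡ-≡ (bounded _) (bounded _) (trans (sym (toℕ-word i)) (trans (cong toℕ e) (toℕ-word i'))))
    (λ e → FP.toℕ-injective (trans (toℕ-word i) (trans (cong (k' ∸_) e) (sym (toℕ-word i')))))

  word<⇔ : ∀ i i' → toℕ (lookup word i') < toℕ (lookup word i) ⇔ g (label i) < g (label i')
  word<⇔ i i' = mk⇔
    (λ lt → ∸-<⇒> (subst₂ _<_ (toℕ-word i') (toℕ-word i) lt))
    (λ lt → subst₂ _<_ (sym (toℕ-word i')) (sym (toℕ-word i)) (NP.∸-monoʳ-< lt (bounded _)))

  module AtPosition (i : Fin n) where

    L : Fin n
    L = label i

    v : ℕ
    v = g L

    before? : ∀ l → Dec (toℕ l < toℕ L × g l ≡ v)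
    before? l = (toℕ l ℕ.<? toℕ L) ×-dec (g l ℕ.≟ v)

    after? : ∀ l → Dec (toℕ L < toℕ l × g l ≡ v)
    after? l = (toℕ L ℕ.<? toℕ l) ×-dec (g l ℕ.≟ v)

    offset-word : offset (counts word) (lookup word i) ≡ count (λ l → v ℕ.<? g l)
    offset-word = begin
      offset (counts word) (lookup word i)
        ≡⟨ offset-counts word (lookup word i) ⟩
      count (λ i' → toℕ (lookup word i') ℕ.<? toℕ (lookup word i))
        ≡⟨ count-cong (λ i' → toℕ (lookup word i') ℕ.<? toℕ (lookup word i)) (λ i' → v ℕ.<? g (label i')) (word<⇔ i) ⟩
      count (λ i' → v ℕ.<? g (label i'))
        ≡⟨ count-permute (λ l → v ℕ.<? g l) (π σ) ⟨
      count (λ l → v ℕ.<? g l) ∎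
      where open ≡-Reasoning

    count-word : lookup (counts word) (lookup word i) ≡ count (λ l → g l ℕ.≟ v)
    count-word = begin
      lookup (counts word) (lookup word i)
        ≡⟨ lookup-counts word (lookup word i) ⟩
      count (λ i' → lookup word i Fin.≟ lookup word i')
        ≡⟨ count-cong (λ i' → lookup word i Fin.≟ lookup word i') (λ i' → g (label i') ℕ.≟ v)
                      (λ i' → mk⇔ (λ e → sym (Equivalence.to (word≡⇔ i i') e))
                                                                  (λ e → Equivalence.from (word≡⇔ i i') (sym e))) ⟩
      count (λ i' → g (label i') ℕ.≟ v)
        ≡⟨ count-permute (λ l → g l ℕ.≟ v) (π σ) ⟨
      count (λ l → g l ℕ.≟ v) ∎
      where open ≡-Reasoning

    rank-word : ∀ s → odd v ≡ s → rank word i ≡ count (λ l → Ordered? s (toℕ l) (toℕ L) ×-dec (g l ℕ.≟ v))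
    rank-word s odd-v = begin
      rank word i
        ≡⟨ rank≡count word i ⟩
      count (λ i' → (toℕ i' ℕ.<? toℕ i) ×-dec (lookup word i' Fin.≟ lookup word i))
        ≡⟨ count-permute (λ i' → (toℕ i' ℕ.<? toℕ i) ×-dec (lookup word i' Fin.≟ lookup word i)) (Perm.flip (π σ)) ⟩
      count (λ l → (toℕ (position l) ℕ.<? toℕ i) ×-dec (lookup word (position l) Fin.≟ lookup word i))
        ≡⟨ count-cong (λ l → (toℕ (position l) ℕ.<? toℕ i) ×-dec (lookup word (position l) Fin.≟ lookup word i))
                      (λ l → Ordered? s (toℕ l) (toℕ L) ×-dec (g l ℕ.≟ v)) same-level-before ⟩
      count (λ l → Ordered? s (toℕ l) (toℕ L) ×-dec (g l ℕ.≟ v)) ∎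
      where
      open ≡-Reasoning
      level : ∀ l → lookup word (position l) ≡ lookup word i ⇔ g l ≡ v
      level l = mk⇔ (λ e → trans (cong g (sym (label-position l))) (Equivalence.to (word≡⇔ _ _) e))
                    (λ e → Equivalence.from (word≡⇔ _ _) (trans (cong g (label-position l)) e))
      ordered : ∀ l → g l ≡ v → toℕ (position l) < toℕ i ⇔ Ordered s (toℕ l) (toℕ L)
      ordered l e = subst₂ (λ p s → toℕ (position l) < toℕ p ⇔ Ordered s (toℕ l) (toℕ L))
                           (position-label i) odd-v (level-order l L e)
      same-level-before : ∀ l → (toℕ (position l) < toℕ i × lookup word (position l) ≡ lookup word i)
                                  ⇔ (Ordered s (toℕ l) (toℕ L) × g l ≡ v)
      same-level-before l = mk⇔
        (λ (lt , e) → let e' = Equivalence.to (level l) e in Equivalence.to (ordered l e') lt , e')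
        (λ (ord , e) → Equivalence.from (ordered l e) ord , Equivalence.from (level l) e)

    label-split : toℕ L ≡ count (λ l → v ℕ.<? g l) ℕ.+ count before?
    label-split = trans (sym (count-toℕ< (toℕ L) (NP.<⇒≤ (FP.toℕ<n L))))
      (count-⊎ (λ l → v ℕ.<? g l) before? (λ l → toℕ l ℕ.<? toℕ L) (λ l → mk⇔ (split l) (join l))
               (λ l v<gl (_ , gl≡v) → NP.<-irrefl (sym gl≡v) v<gl))
      where
      split : ∀ l → toℕ l < toℕ L → v < g l ⊎ (toℕ l < toℕ L × g l ≡ v)
      split l l<L with v ℕ.<? g l
      ... | yes v<gl = inj₁ v<gl
      ... | no v≮gl  = inj₂ (l<L , NP.≤-antisym (NP.≮⇒≥ v≮gl) (antitone l L (NP.<⇒≤ l<L)))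
      join : ∀ l → v < g l ⊎ (toℕ l < toℕ L × g l ≡ v) → toℕ l < toℕ L
      join l (inj₁ v<gl)      = NP.≰⇒> (λ L≤l → NP.<⇒≱ v<gl (antitone L l L≤l))
      join l (inj₂ (l<L , _)) = l<L

    level-split : count (λ l → g l ℕ.≟ v) ≡ count before? ℕ.+ suc (count after?)
    level-split = trans
      (count-⊎ before? at-or-after? (λ l → g l ℕ.≟ v)
        (λ l → mk⇔ (split₁ l) (λ { (inj₁ (_ , e)) → e ; (inj₂ (_ , e)) → e }))
        (λ l (l<L , _) (L≤l , _) → NP.<⇒≱ l<L L≤l))
      (cong (count before? ℕ.+_) (trans
        (count-⊎ (λ l → l Fin.≟ L) after? at-or-after?
          (λ l → mk⇔ (split₂ l) (λ { (inj₁ refl) → NP.≤-refl , refl ; (inj₂ (L<l , e)) → NP.<⇒≤ L<l , e }))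
          (λ { l refl (L<L , _) → NP.<-irrefl refl L<L }))
        (cong (ℕ._+ count after?) (count-≡ L))))
      where
      at-or-after? : ∀ l → Dec (toℕ L ≤ toℕ l × g l ≡ v)
      at-or-after? l = (toℕ L ℕ.≤? toℕ l) ×-dec (g l ℕ.≟ v)
      split₁ : ∀ l → g l ≡ v → (toℕ l < toℕ L × g l ≡ v) ⊎ (toℕ L ≤ toℕ l × g l ≡ v)
      split₁ l e with toℕ l ℕ.<? toℕ L
      ... | yes l<L = inj₁ (l<L , e)
      ... | no l≮L  = inj₂ (NP.≮⇒≥ l≮L , e)
      split₂ : ∀ l → toℕ L ≤ toℕ l × g l ≡ v → l ≡ L ⊎ (toℕ L < toℕ l × g l ≡ v)
      split₂ l (L≤l , e) with NP.m≤n⇒m<n∨m≡n L≤l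
      ... | inj₁ L<l = inj₂ (L<l , e)
      ... | inj₂ L≡l = inj₁ (FP.toℕ-injective (sym L≡l))

    flippedStack-word : flippedStack (lookup word i) ≡ odd v
    flippedStack-word = begin
      flipped k (suc (toℕ (lookup word i))) ≡⟨ flipped≡odd k _ (s≤s (toℕ≤k' (lookup word i))) ⟩
      odd (k' ∸ toℕ (lookup word i))        ≡⟨ cong (λ x → odd (k' ∸ x)) (toℕ-word i) ⟩
      odd (k' ∸ (k' ∸ v))                   ≡⟨ cong odd (NP.m∸[m∸n]≡n (bounded L)) ⟩
      odd v                                 ∎
      where open ≡-Reasoning

    placedLabel-word : toℕ L ≡ placedLabel word i
    placedLabel-word with flippedStack (lookup word i) in fl
    ... | false = trans label-split (cong₂ ℕ._+_ (sym offset-word) (sym (rank-word false (trans (sym flippedStack-word) fl))))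
    ... | true  = trans label-split (cong₂ ℕ._+_ (sym offset-word) (sym (begin
      lookup (counts word) (lookup word i) ∸ suc (rank word i)
        ≡⟨ cong₂ (λ c r → c ∸ suc r) (trans count-word level-split) (rank-word true (trans (sym flippedStack-word) fl)) ⟩
      count before? ℕ.+ suc (count after?) ∸ suc (count after?)
        ≡⟨ NP.m+n∸n≡m (count before?) (suc (count after?)) ⟩
      count before? ∎)))
      where open ≡-Reasoning

    sign-word : neg σ i ≡ flippedStack (lookup word i)
    sign-word = trans (cong (neg σ) (sym (position-label i))) (trans (sym (parity L)) (sym flippedStack-word))

  word-produces : ∀ i → target i ≡ placed word i
  word-produces i = Equivalence.from (target≡placed⇔ word i) (AtPosition.sign-word i , AtPosition.placedLabel-word i)

⌈/2⌉-even : ∀ x → odd x ≡ false → 2 ℕ.* ⌈ x /2⌉ ≡ x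
⌈/2⌉-even zero          _      = refl
⌈/2⌉-even (suc (suc x)) x-even = trans (NP.*-suc 2 ⌈ x /2⌉) (cong (2 ℕ.+_) (⌈/2⌉-even x x-even))

⌈/2⌉-odd : ∀ x → odd x ≡ true → 2 ℕ.* ⌈ x /2⌉ ≡ suc x
⌈/2⌉-odd (suc zero)    _     = refl
⌈/2⌉-odd (suc (suc x)) x-odd = trans (NP.*-suc 2 ⌈ x /2⌉) (cong (2 ℕ.+_) (⌈/2⌉-odd x x-odd))

⌈/2⌉-injective : ∀ x y → ⌈ x /2⌉ ≡ ⌈ y /2⌉ → odd x ≡ odd y → x ≡ y
⌈/2⌉-injective x y eq same-parity with odd x in px | odd y in py
... | true  | true  = NP.suc-injective (trans (sym (⌈/2⌉-odd x px)) (trans (cong (2 ℕ.*_) eq) (⌈/2⌉-odd y py)))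
... | false | false = trans (sym (⌈/2⌉-even x px)) (trans (cong (2 ℕ.*_) eq) (⌈/2⌉-even y py))

⌈/2⌉-tie : ∀ x y → y < x → ⌈ y /2⌉ ≡ ⌈ x /2⌉ → odd x ≡ false × odd y ≡ true
⌈/2⌉-tie x y y<x eq with odd x in px | odd y in py
... | false | true  = refl , refl
... | false | false = ⊥-elim (NP.<-irrefl (trans (sym (⌈/2⌉-even y py)) (trans (cong (2 ℕ.*_) eq) (⌈/2⌉-even x px))) y<x)
... | true  | _     = ⊥-elim (NP.<-irrefl refl (begin-strict
  suc x                ≡⟨ ⌈/2⌉-odd x px ⟨
  2 ℕ.* ⌈ x /2⌉        ≡⟨ cong (2 ℕ.*_) eq ⟨
  2 ℕ.* ⌈ y /2⌉        ≤⟨ two⌈y/2⌉≤suc-y ⟩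
  suc y                ≤⟨ y<x ⟩
  x                    <⟨ NP.n<1+n x ⟩
  suc x                ∎))
  where
  open NP.≤-Reasoning
  two⌈y/2⌉≤suc-y : 2 ℕ.* ⌈ y /2⌉ ≤ suc y
  two⌈y/2⌉≤suc-y with odd y in py
  ... | true  = NP.≤-reflexive (⌈/2⌉-odd y py)
  ... | false = NP.≤-trans (NP.≤-reflexive (⌈/2⌉-even y py)) (NP.n≤1+n y)

⌈/2⌉≡0 : ∀ x → ⌈ x /2⌉ ≡ 0 → x ≡ 0
⌈/2⌉≡0 zero _ = refl

-- The inverse of ⌈_/2⌉ on numbers of parity s, with a junk value at s = true, x = 0.
unhalve : Bool → ℕ → ℕ
unhalve false x       = 2 ℕ.* x
unhalve true  zero    = 0
unhalve true  (suc x) = suc (2 ℕ.* x)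

odd-2* : ∀ x → odd (2 ℕ.* x) ≡ false
odd-2* zero    = refl
odd-2* (suc x) rewrite NP.*-suc 2 x = odd-2* x

⌈2*/2⌉ : ∀ x → ⌈ 2 ℕ.* x /2⌉ ≡ x
⌈2*/2⌉ zero    = refl
⌈2*/2⌉ (suc x) = trans (cong ⌈_/2⌉ (NP.*-suc 2 x)) (cong suc (⌈2*/2⌉ x))

⌊2*/2⌋ : ∀ x → ℕ.⌊ 2 ℕ.* x /2⌋ ≡ x
⌊2*/2⌋ zero    = refl
⌊2*/2⌋ (suc x) = trans (cong ℕ.⌊_/2⌋ (NP.*-suc 2 x)) (cong suc (⌊2*/2⌋ x))

odd-unhalve : ∀ s x → (s ≡ true → 0 < x) → odd (unhalve s x) ≡ s
odd-unhalve false x       _   = odd-2* x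
odd-unhalve true  zero    pos with () ← pos refl
odd-unhalve true  (suc x) _   rewrite isEven-suc (2 ℕ.* x) | odd-2* x = refl

⌈unhalve/2⌉ : ∀ s x → (s ≡ true → 0 < x) → ⌈ unhalve s x /2⌉ ≡ x
⌈unhalve/2⌉ false x       _   = ⌈2*/2⌉ x
⌈unhalve/2⌉ true  zero    pos with () ← pos refl
⌈unhalve/2⌉ true  (suc x) _   = cong suc (⌊2*/2⌋ x)

unhalve≤2* : ∀ s x → unhalve s x ≤ 2 ℕ.* x
unhalve≤2* false x       = NP.≤-refl
unhalve≤2* true  zero    = z≤n
unhalve≤2* true  (suc x) = NP.≤-trans (NP.n≤1+n _) (NP.≤-reflexive (sym (NP.*-suc 2 x)))

unhalve-< : ∀ s s' {x y} → x < y → unhalve s x < unhalve s' y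
unhalve-< s s' {x} {suc y} (s≤s x≤y) = NP.≤-<-trans (unhalve≤2* s x) (NP.<-≤-trans (s≤s (NP.*-monoʳ-≤ 2 x≤y)) (above s'))
  where
  above : ∀ s' → suc (2 ℕ.* y) ≤ unhalve s' (suc y)
  above false = NP.≤-trans (NP.n≤1+n _) (NP.≤-reflexive (sym (NP.*-suc 2 y)))
  above true  = NP.≤-refl

-- Ascent s s' p p' : ε e_p − ε' e_p' is a positive root, where ε = −1 iff s, and ε' = −1 iff s'.
Ascent : ∀ {n} → Bool → Bool → Fin n → Fin n → Set
Ascent false true  p p' = ⊤
Ascent true  false p p' = ⊥
Ascent false false p p' = toℕ p < toℕ p'
Ascent true  true  p p' = toℕ p' < toℕ p

Ascent? : ∀ {n} s s' (p p' : Fin n) → Dec (Ascent s s' p p')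
Ascent? false true  p p' = yes tt
Ascent? true  false p p' = no (λ ())
Ascent? false false p p' = toℕ p ℕ.<? toℕ p'
Ascent? true  true  p p' = toℕ p' ℕ.<? toℕ p

Ordered⇒Ascent : ∀ {n} s {p p' : Fin n} → Ordered s (toℕ p) (toℕ p') → Ascent s s p p'
Ordered⇒Ascent false ord = ord
Ordered⇒Ascent true  ord = ord

module Halving (m k' : ℕ) (σ : SignedPerm (suc m)) where

  open Heights (suc m) k' σ public

  last : Fin (suc m)
  last = fromℕ m

  record HalfAdmissible (h : Fin (suc m) → ℕ) : Set where
    field
      top    : 2 ℕ.* h zero < k ⊎ (2 ℕ.* h zero ≡ k × faceUp zero ≡ true)
      bottom : ∀ l → toℕ l ≡ m → 0 < h l ⊎ (h l ≡ 0 × faceUp l ≡ false)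
      step   : ∀ l l' → suc (toℕ l) ≡ toℕ l' →
               h l' < h l ⊎ (h l ≡ h l' × Ascent (faceUp l) (faceUp l') (position l) (position l'))

  halve-Admissible : ∀ g → Admissible g → HalfAdmissible (λ l → ⌈ g l /2⌉)
  halve-Admissible g adm .HalfAdmissible.top with odd (g zero) in odd-g₀
  ... | false = inj₁ (s≤s (NP.≤-trans (NP.≤-reflexive (⌈/2⌉-even (g zero) odd-g₀)) (Admissible.bounded adm zero)))
  ... | true with NP.m≤n⇒m<n∨m≡n (s≤s (Admissible.bounded adm zero))
  ...   | inj₁ lt = inj₁ (subst (_< k) (sym (⌈/2⌉-odd (g zero) odd-g₀)) lt)
  ...   | inj₂ eq = inj₂ (trans (⌈/2⌉-odd (g zero) odd-g₀) eq , trans (sym (Admissible.parity adm zero)) odd-g₀)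
  halve-Admissible g adm .HalfAdmissible.bottom l _ with ⌈ g l /2⌉ in h≡
  ... | suc _ = inj₁ (s≤s z≤n)
  ... | zero  = inj₂ (refl , trans (sym (Admissible.parity adm l)) (cong odd (⌈/2⌉≡0 (g l) h≡)))
  halve-Admissible g adm .HalfAdmissible.step l l' next with Admissible.step adm l l' next
  ... | inj₂ (g≡ , ord) = inj₂ (cong ⌈_/2⌉ g≡ , subst (λ s → Ascent (faceUp l) s (position l) (position l'))
          (trans (sym (Admissible.parity adm l)) (trans (cong odd g≡) (Admissible.parity adm l')))
          (Ordered⇒Ascent (faceUp l) ord))
  ... | inj₁ g'<g with NP.m≤n⇒m<n∨m≡n (NP.⌈n/2⌉-mono (NP.<⇒≤ g'<g))
  ...   | inj₁ h'<h = inj₁ h'<h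
  ...   | inj₂ h'≡h with ⌈/2⌉-tie (g l) (g l') g'<g h'≡h
  ...     | even , odd' = inj₂ (sym h'≡h , subst₂ (λ s s' → Ascent s s' (position l) (position l'))
              (trans (sym even) (Admissible.parity adm l)) (trans (sym odd') (Admissible.parity adm l')) tt)

  module Unhalving (h : Fin (suc m) → ℕ) (half : HalfAdmissible h) where

    open HalfAdmissible half

    g : Fin (suc m) → ℕ
    g l = unhalve (faceUp l) (h l)

    private
      Q : Fin (suc m) → Fin (suc m) → Set
      Q a b = h b ≤ h a × (h a ≡ h b → faceUp a ≡ true → faceUp b ≡ true)

      Q-trans : ∀ {a b c} → Q a b → Q b c → Q a c
      Q-trans {a} {b} {c} (b≤a , up-ab) (c≤b , up-bc) = NP.≤-trans c≤b b≤a , λ a≡c up →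
        let a≡b = NP.≤-antisym (subst (_≤ h b) (sym a≡c) c≤b) b≤a in up-bc (trans (sym a≡b) a≡c) (up-ab a≡b up)

      Ascent-up : ∀ s {p p' : Fin (suc m)} → Ascent true s p p' → s ≡ true
      Ascent-up true _ = refl

      Q-step : ∀ a b → suc (toℕ a) ≡ toℕ b → Q a b
      Q-step a b next with step a b next
      ... | inj₁ b<a         = NP.<⇒≤ b<a , λ a≡b → ⊥-elim (NP.<-irrefl (sym a≡b) b<a)
      ... | inj₂ (a≡b , asc) = NP.≤-reflexive (sym a≡b) , λ _ up →
        Ascent-up (faceUp b) (subst (λ s → Ascent s (faceUp b) (position a) (position b)) up asc)

    chain : ∀ a b → toℕ a < toℕ b → Q a b
    chain = <-chain Q Q-trans Q-step

    private
      last-faceUp⇒positive : ∀ l → toℕ l ≡ m → faceUp l ≡ true → 0 < h l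
      last-faceUp⇒positive l l≡m up with bottom l l≡m
      ... | inj₁ pos        = pos
      ... | inj₂ (_ , down) = ⊥-elim (true≢false (trans (sym up) down))

    -- A face-up card sits at height 2 h − 1, so h must be positive.
    faceUp⇒positive : ∀ l → faceUp l ≡ true → 0 < h l
    faceUp⇒positive l up with toℕ l ℕ.≟ m
    ... | yes l≡m = last-faceUp⇒positive l l≡m up
    ... | no l≢m with h l in h≡
    ...   | suc _ = s≤s z≤n
    ...   | zero  = ⊥-elim (NP.<-irrefl (sym h-last≡0)
                      (last-faceUp⇒positive last (FP.toℕ-fromℕ m) (proj₂ below (trans h≡ (sym h-last≡0)) up)))
      where
      below : Q l last
      below = chain l last (subst (toℕ l <_) (sym (FP.toℕ-fromℕ m)) (NP.≤∧≢⇒< (NP.≤-pred (FP.toℕ<n l)) l≢m))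
      h-last≡0 : h last ≡ 0
      h-last≡0 = NP.n≤0⇒n≡0 (subst (h last ≤_) h≡ (proj₁ below))

    ⌈g/2⌉ : ∀ l → ⌈ g l /2⌉ ≡ h l
    ⌈g/2⌉ l = ⌈unhalve/2⌉ (faceUp l) (h l) (faceUp⇒positive l)

    g-Admissible : Admissible g
    g-Admissible = record { bounded = bounded ; parity = λ l → odd-unhalve (faceUp l) (h l) (faceUp⇒positive l) ; step = step′ }
      where
      g₀≤k' : g zero ≤ k'
      g₀≤k' with top
      ... | inj₁ lt                   = NP.≤-trans (unhalve≤2* (faceUp zero) (h zero)) (NP.≤-pred lt)
      ... | inj₂ (eq , up) rewrite up = tight (h zero) eq
        where
        tight : ∀ x → 2 ℕ.* x ≡ k → unhalve true x ≤ k'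
        tight (suc x) eq = NP.≤-reflexive (NP.suc-injective (trans (sym (NP.*-suc 2 x)) eq))
      bounded : ∀ l → g l ≤ k'
      bounded zero    = g₀≤k'
      bounded (suc l) = NP.≤-trans below-top g₀≤k'
        where
        below-top : g (suc l) ≤ g zero
        below-top with chain zero (suc l) (s≤s z≤n)
        ... | hl≤h₀ , up-up with NP.m≤n⇒m<n∨m≡n hl≤h₀
        ...   | inj₁ hl<h₀ = NP.<⇒≤ (unhalve-< (faceUp (suc l)) (faceUp zero) hl<h₀)
        ...   | inj₂ hl≡h₀ with faceUp zero
        ...     | true  = NP.≤-reflexive (trans (cong (λ s → unhalve s (h (suc l))) (up-up (sym hl≡h₀) refl))
                                                (cong (unhalve true) hl≡h₀))
        ...     | false = NP.≤-trans (unhalve≤2* (faceUp (suc l)) (h (suc l))) (NP.≤-reflexive (cong (2 ℕ.*_) hl≡h₀))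
      step′ : ∀ l l' → suc (toℕ l) ≡ toℕ l' →
        g l' < g l ⊎ (g l ≡ g l' × Ordered (faceUp l) (toℕ (position l)) (toℕ (position l')))
      step′ l l' next with step l l' next
      ... | inj₁ h'<h = inj₁ (unhalve-< (faceUp l') (faceUp l) h'<h)
      ... | inj₂ (h≡ , asc) with faceUp l in up | faceUp l' in up'
      ...   | false | false = inj₂ (cong (2 ℕ.*_) h≡ , asc)
      ...   | true  | true  = inj₂ (cong (unhalve true) h≡ , asc)
      ...   | false | true  = inj₁ (face-down-above (h l') (faceUp⇒positive l' up') (sym h≡))
        where
        face-down-above : ∀ x → 0 < x → ∀ {y} → x ≡ y → unhalve true x < unhalve false y
        face-down-above (suc x) _ refl = NP.≤-reflexive (sym (NP.*-suc 2 x))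

-- Roots and descents

≡ᵇ-≡ : ∀ a b → a ≡ b → (a ≡ᵇ b) ≡ true
≡ᵇ-≡ a b a≡b with a ≡ᵇ b | NP.≡⇒≡ᵇ a b a≡b
... | true | _ = refl

≡ᵇ-≢ : ∀ a b → a ≢ b → (a ≡ᵇ b) ≡ false
≡ᵇ-≢ a b a≢b with a ≡ᵇ b in eq
... | true  = ⊥-elim (a≢b (NP.≡ᵇ⇒≡ a b (subst T (sym eq) tt)))
... | false = refl

unit-≡ : ∀ {n} (i : Fin n) → unit i i ≡ + 1
unit-≡ i rewrite ≡ᵇ-≡ (toℕ i) (toℕ i) refl = refl

unit-≢ : ∀ {n} (i t : Fin n) → i ≢ t → unit i t ≡ + 0
unit-≢ i t i≢t rewrite ≡ᵇ-≢ (toℕ i) (toℕ t) (λ e → i≢t (FP.toℕ-injective e)) = refl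

sgn : Bool → ℤ
sgn true  = - (+ 1)
sgn false = + 1

not-last : ∀ m (l l' : Fin (suc m)) → suc (toℕ l) ≡ toℕ l' → (toℕ l ≡ᵇ m) ≡ false
not-last m l l' next = ≡ᵇ-≢ (toℕ l) m
  (λ l≡m → NP.<-irrefl refl (subst (ℕ._≤ m) (trans (sym next) (cong suc l≡m)) (NP.≤-pred (FP.toℕ<n l'))))

simpleRoot-inner : ∀ m (i : Fin (suc m)) → (toℕ i ≡ᵇ m) ≡ false → ∀ x →
  simpleRoot m (suc i) x ≡ (if toℕ x ≡ᵇ toℕ i then + 1 else (if toℕ x ≡ᵇ suc (toℕ i) then - (+ 1) else + 0))
simpleRoot-inner m i inner x rewrite inner = refl

simpleRoot-last : ∀ m (i : Fin (suc m)) → (toℕ i ≡ᵇ m) ≡ true → ∀ x →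
  simpleRoot m (suc i) x ≡ (if toℕ x ≡ᵇ toℕ i then + 2 else + 0)
simpleRoot-last m i last x rewrite last = refl

private
  <ᶠ⇒≢ : ∀ {n} {i j : Fin n} → i <ᶠ j → i ≢ j
  <ᶠ⇒≢ i<j refl = NP.<-irrefl refl i<j

  +1≢0 : + 1 ≢ + 0
  +1≢0 ()

  -1≢0 : - (+ 1) ≢ + 0
  -1≢0 ()

  +2≢0 : + 2 ≢ + 0
  +2≢0 ()

  sub-units-at : ∀ {n} {z : Vecℤ n} {i j} → i <ᶠ j → (∀ t → z t ≡ unit i t ℤ.- unit j t) → z i ≡ + 1 × z j ≡ - (+ 1)
  sub-units-at {i = i} {j} i<j h rewrite h i | h j | unit-≡ i | unit-≡ j
    | unit-≢ j i (λ e → <ᶠ⇒≢ i<j (sym e)) | unit-≢ i j (<ᶠ⇒≢ i<j) = refl , refl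

  add-units-at : ∀ {n} {z : Vecℤ n} {i j} → i <ᶠ j → (∀ t → z t ≡ unit i t ℤ.+ unit j t) → z i ≡ + 1 × z j ≡ + 1
  add-units-at {i = i} {j} i<j h rewrite h i | h j | unit-≡ i | unit-≡ j
    | unit-≢ j i (λ e → <ᶠ⇒≢ i<j (sym e)) | unit-≢ i j (<ᶠ⇒≢ i<j) = refl , refl

  double-unit-at : ∀ {n} {z : Vecℤ n} {i} → (∀ t → z t ≡ + 2 ℤ.* unit i t) → z i ≡ + 2
  double-unit-at {i = i} h rewrite h i | unit-≡ i = refl

  ≡-two-units : ∀ {n} {z : Vecℤ n} (a b : Fin n) → a ≢ b → (f : ℤ → ℤ → ℤ) → z a ≡ f (+ 1) (+ 0) → z b ≡ f (+ 0) (+ 1) →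
    f (+ 0) (+ 0) ≡ + 0 → (∀ t → t ≢ a → t ≢ b → z t ≡ + 0) → ∀ t → z t ≡ f (unit a t) (unit b t)
  ≡-two-units {z = z} a b a≢b f za zb f00 z0 t with t Fin.≟ a | t Fin.≟ b
  ... | yes refl | _        rewrite unit-≡ a | unit-≢ b a (λ e → a≢b (sym e)) = za
  ... | no _     | yes refl rewrite unit-≡ b | unit-≢ a b a≢b = zb
  ... | no t≢a   | no t≢b   rewrite unit-≢ a t (λ e → t≢a (sym e)) | unit-≢ b t (λ e → t≢b (sym e)) =
    trans (z0 t t≢a t≢b) (sym f00)

  NotAscent : ∀ {n} → Bool → Bool → Fin n → Fin n → Set
  NotAscent s s' p q = (s ≡ true × s' ≡ true × p <ᶠ q) ⊎ (s ≡ false × s' ≡ false × q <ᶠ p) ⊎ (s ≡ true × s' ≡ false)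

  NotAscent⇔¬Ascent : ∀ {n} s s' {p q : Fin n} → p ≢ q → NotAscent s s' p q ⇔ (¬ Ascent s s' p q)
  NotAscent⇔¬Ascent s s' {p} {q} p≢q = mk⇔ (⇒ s s') (⇐ s s')
    where
    ⇒ : ∀ s s' → NotAscent s s' p q → ¬ Ascent s s' p q
    ⇒ _ _ (inj₁ (refl , refl , p<q))        q<p = NP.<-asym p<q q<p
    ⇒ _ _ (inj₂ (inj₁ (refl , refl , q<p))) p<q = NP.<-asym p<q q<p
    ⇒ _ _ (inj₂ (inj₂ (refl , refl)))       ()
    ⇐ : ∀ s s' → ¬ Ascent s s' p q → NotAscent s s' p q
    ⇐ false true  ¬asc = ⊥-elim (¬asc tt)
    ⇐ true  false ¬asc = inj₂ (inj₂ (refl , refl))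
    ⇐ false false ¬asc with NP.<-cmp (toℕ p) (toℕ q)
    ... | tri< p<q _ _ = ⊥-elim (¬asc p<q)
    ... | tri≈ _ p≡q _ = ⊥-elim (p≢q (FP.toℕ-injective p≡q))
    ... | tri> _ _ q<p = inj₂ (inj₁ (refl , refl , q<p))
    ⇐ true  true  ¬asc with NP.<-cmp (toℕ p) (toℕ q)
    ... | tri< p<q _ _ = inj₁ (refl , refl , p<q)
    ... | tri≈ _ p≡q _ = ⊥-elim (p≢q (FP.toℕ-injective p≡q))
    ... | tri> _ _ q<p = ⊥-elim (¬asc q<p)

-- z = sgn (not s) e_p + sgn s' e_q, i.e. z = − (ε e_p − ε' e_q) with ε = sgn s, ε' = sgn s'.
module TwoPoint {n} (z : Vecℤ n) (p q : Fin n) (p≢q : p ≢ q) (s s' : Bool)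
                (zp : z p ≡ sgn (not s)) (zq : z q ≡ sgn s') (z0 : ∀ t → t ≢ p → t ≢ q → z t ≡ + 0) where

  private
    support : ∀ t → z t ≢ + 0 → t ≡ p ⊎ t ≡ q
    support t zt≢0 with t Fin.≟ p | t Fin.≟ q
    ... | yes t≡p | _       = inj₁ t≡p
    ... | no _    | yes t≡q = inj₂ t≡q
    ... | no t≢p  | no t≢q  = ⊥-elim (zt≢0 (z0 t t≢p t≢q))

    sgn-+1 : ∀ b → sgn b ≡ + 1 → b ≡ false
    sgn-+1 false _ = refl

    sgn--1 : ∀ b → sgn b ≡ - (+ 1) → b ≡ true
    sgn--1 true _ = refl

    sgn≢2 : ∀ b → sgn b ≢ + 2
    sgn≢2 true  ()
    sgn≢2 false ()

    not-injective : ∀ {a b} → not a ≡ not b → a ≡ b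
    not-injective {false} {false} _ = refl
    not-injective {true}  {true}  _ = refl

    positive⇒NotAscent : IsPosRoot z → NotAscent s s' p q
    positive⇒NotAscent (inj₁ (i , j , i<j , h)) with sub-units-at i<j h
    ... | zi , zj with support i (λ e → +1≢0 (trans (sym zi) e)) | support j (λ e → -1≢0 (trans (sym zj) e))
    ... | inj₁ refl | inj₁ refl = ⊥-elim (<ᶠ⇒≢ i<j refl)
    ... | inj₁ refl | inj₂ refl = inj₁ (not-injective (sgn-+1 _ (trans (sym zp) zi)) , sgn--1 s' (trans (sym zq) zj) , i<j)
    ... | inj₂ refl | inj₁ refl = inj₂ (inj₁ (not-injective (sgn--1 _ (trans (sym zp) zj)) , sgn-+1 s' (trans (sym zq) zi) , i<j))
    ... | inj₂ refl | inj₂ refl = ⊥-elim (<ᶠ⇒≢ i<j refl)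
    positive⇒NotAscent (inj₂ (inj₁ (i , j , i<j , h))) with add-units-at i<j h
    ... | zi , zj with support i (λ e → +1≢0 (trans (sym zi) e)) | support j (λ e → +1≢0 (trans (sym zj) e))
    ... | inj₁ refl | inj₁ refl = ⊥-elim (<ᶠ⇒≢ i<j refl)
    ... | inj₁ refl | inj₂ refl = inj₂ (inj₂ (not-injective (sgn-+1 _ (trans (sym zp) zi)) , sgn-+1 s' (trans (sym zq) zj)))
    ... | inj₂ refl | inj₁ refl = inj₂ (inj₂ (not-injective (sgn-+1 _ (trans (sym zp) zj)) , sgn-+1 s' (trans (sym zq) zi)))
    ... | inj₂ refl | inj₂ refl = ⊥-elim (<ᶠ⇒≢ i<j refl)
    positive⇒NotAscent (inj₂ (inj₂ (i , h))) with support i (λ e → +2≢0 (trans (sym (double-unit-at h)) e))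
    ... | inj₁ refl = ⊥-elim (sgn≢2 (not s) (trans (sym zp) (double-unit-at h)))
    ... | inj₂ refl = ⊥-elim (sgn≢2 s' (trans (sym zq) (double-unit-at h)))

    NotAscent⇒positive : NotAscent s s' p q → IsPosRoot z
    NotAscent⇒positive (inj₁ (refl , refl , p<q)) = inj₁ (p , q , p<q , ≡-two-units p q p≢q ℤ._-_ zp zq refl z0)
    NotAscent⇒positive (inj₂ (inj₁ (refl , refl , q<p))) =
      inj₁ (q , p , q<p , ≡-two-units q p (λ e → p≢q (sym e)) ℤ._-_ zq zp refl (λ t t≢q t≢p → z0 t t≢p t≢q))
    NotAscent⇒positive (inj₂ (inj₂ (refl , refl))) with NP.<-cmp (toℕ p) (toℕ q)
    ... | tri< p<q _ _ = inj₂ (inj₁ (p , q , p<q , ≡-two-units p q p≢q ℤ._+_ zp zq refl z0))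
    ... | tri≈ _ p≡q _ = ⊥-elim (p≢q (FP.toℕ-injective p≡q))
    ... | tri> _ _ q<p =
      inj₂ (inj₁ (q , p , q<p , ≡-two-units q p (λ e → p≢q (sym e)) ℤ._+_ zq zp refl (λ t t≢q t≢p → z0 t t≢p t≢q)))

  IsPosRoot⇔¬Ascent : IsPosRoot z ⇔ (¬ Ascent s s' p q)
  IsPosRoot⇔¬Ascent = mk⇔ (λ pos → Equivalence.to (NotAscent⇔¬Ascent s s' p≢q) (positive⇒NotAscent pos))
                          (λ ¬asc → NotAscent⇒positive (Equivalence.from (NotAscent⇔¬Ascent s s' p≢q) ¬asc))

module OnePoint {n} (z : Vecℤ n) (p : Fin n) (s : Bool)
                (zp : z p ≡ (if s then - (+ 2) else + 2)) (z0 : ∀ t → t ≢ p → z t ≡ + 0) where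

  private
    support : ∀ t → z t ≢ + 0 → t ≡ p
    support t zt≢0 with t Fin.≟ p
    ... | yes t≡p = t≡p
    ... | no t≢p  = ⊥-elim (zt≢0 (z0 t t≢p))

    positive⇒ : IsPosRoot z → s ≡ false
    positive⇒ (inj₁ (i , j , i<j , h)) with sub-units-at i<j h
    ... | zi , zj with support i (λ e → +1≢0 (trans (sym zi) e)) | support j (λ e → -1≢0 (trans (sym zj) e))
    ... | refl | refl = ⊥-elim (<ᶠ⇒≢ i<j refl)
    positive⇒ (inj₂ (inj₁ (i , j , i<j , h))) with add-units-at i<j h
    ... | zi , zj with support i (λ e → +1≢0 (trans (sym zi) e)) | support j (λ e → +1≢0 (trans (sym zj) e))
    ... | refl | refl = ⊥-elim (<ᶠ⇒≢ i<j refl)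
    positive⇒ (inj₂ (inj₂ (i , h))) with support i (λ e → +2≢0 (trans (sym (double-unit-at h)) e))
    ... | refl = sign s (trans (sym zp) (double-unit-at h))
      where
      sign : ∀ s → (if s then - (+ 2) else + 2) ≡ + 2 → s ≡ false
      sign false _ = refl

  IsPosRoot⇔ : IsPosRoot z ⇔ s ≡ false
  IsPosRoot⇔ = mk⇔ positive⇒ λ s≡false → inj₂ (inj₂ (p , pointwise s≡false))
    where
    pointwise : s ≡ false → ∀ t → z t ≡ + 2 ℤ.* unit p t
    pointwise s≡false t with t Fin.≟ p
    ... | yes refl rewrite unit-≡ p = trans zp (cong (λ b → if b then - (+ 2) else + 2) s≡false)
    ... | no t≢p   rewrite unit-≢ p t (λ e → t≢p (sym e)) = z0 t t≢p

module Descents (m : ℕ) (σ : SignedPerm (suc m)) where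

  open Labelling {suc m} σ

  w : SignedPerm (suc m)
  w = inv σ

  -- −w(α_a): α_a ∈ Cdes(w) means exactly that this vector is a positive root
  −image : Fin (suc (suc m)) → Vecℤ (suc m)
  −image a t = - act w (simpleRoot m a) t

  −image-at : ∀ a t → −image a t ≡ - (if neg σ t then - simpleRoot m a (label t) else simpleRoot m a (label t))
  −image-at a t rewrite position-label t = refl

  private
    label≢ : ∀ t l → t ≢ position l → label t ≢ l
    label≢ t l t≢ label≡ = t≢ (trans (sym (position-label t)) (cong position label≡))

  α₀∈Cdes⇔ : InCdes m w zero ⇔ faceUp zero ≡ false
  α₀∈Cdes⇔ = OnePoint.IsPosRoot⇔ (−image zero) (position zero) (faceUp zero) at off
    where
    at : −image zero (position zero) ≡ (if faceUp zero then - (+ 2) else + 2)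
    at rewrite −image-at zero (position zero) | label-position zero with faceUp zero
    ... | true  = refl
    ... | false = refl
    off : ∀ t → t ≢ position zero → −image zero t ≡ + 0
    off t t≢ rewrite −image-at zero t | ≡ᵇ-≢ (toℕ (label t)) 0 (λ e → label≢ t zero t≢ (FP.toℕ-injective e)) with neg σ t
    ... | true  = refl
    ... | false = refl

  αₙ∈Cdes⇔ : ∀ l → toℕ l ≡ m → InCdes m w (suc l) ⇔ faceUp l ≡ true
  αₙ∈Cdes⇔ l l≡m = mk⇔ (λ c → not-false (Equivalence.to onePoint c)) (λ up → Equivalence.from onePoint (cong not up))
    where
    last : (toℕ l ≡ᵇ m) ≡ true
    last = ≡ᵇ-≡ (toℕ l) m l≡m
    at : −image (suc l) (position l) ≡ (if not (faceUp l) then - (+ 2) else + 2)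
    at rewrite −image-at (suc l) (position l) | label-position l | simpleRoot-last m l last l | ≡ᵇ-≡ (toℕ l) (toℕ l) refl with faceUp l
    ... | true  = refl
    ... | false = refl
    off : ∀ t → t ≢ position l → −image (suc l) t ≡ + 0
    off t t≢ rewrite −image-at (suc l) t | simpleRoot-last m l last (label t)
      | ≡ᵇ-≢ (toℕ (label t)) (toℕ l) (λ e → label≢ t l t≢ (FP.toℕ-injective e)) with neg σ t
    ... | true  = refl
    ... | false = refl
    onePoint : IsPosRoot (−image (suc l)) ⇔ not (faceUp l) ≡ false
    onePoint = OnePoint.IsPosRoot⇔ (−image (suc l)) (position l) (not (faceUp l)) at off
    not-false : ∀ {b} → not b ≡ false → b ≡ true
    not-false {true} _ = refl

  αᵢ∈Cdes⇔ : ∀ l l' → suc (toℕ l) ≡ toℕ l' →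
    InCdes m w (suc l) ⇔ (¬ Ascent (faceUp l) (faceUp l') (position l) (position l'))
  αᵢ∈Cdes⇔ l l' next = TwoPoint.IsPosRoot⇔¬Ascent (−image (suc l)) (position l) (position l') p≢q (faceUp l) (faceUp l') at at' off
    where
    inner : (toℕ l ≡ᵇ m) ≡ false
    inner = not-last m l l' next
    l'≢l : toℕ l' ≢ toℕ l
    l'≢l e = NP.<-irrefl (trans (sym e) (sym next)) (NP.n<1+n _)
    p≢q : position l ≢ position l'
    p≢q e = l'≢l (cong toℕ (sym (trans (sym (label-position l)) (trans (cong label e) (label-position l')))))
    at : −image (suc l) (position l) ≡ sgn (not (faceUp l))
    at rewrite −image-at (suc l) (position l) | label-position l | simpleRoot-inner m l inner l | ≡ᵇ-≡ (toℕ l) (toℕ l) refl with faceUp l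
    ... | true  = refl
    ... | false = refl
    at' : −image (suc l) (position l') ≡ sgn (faceUp l')
    at' rewrite −image-at (suc l) (position l') | label-position l' | simpleRoot-inner m l inner l'
      | ≡ᵇ-≢ (toℕ l') (toℕ l) l'≢l | ≡ᵇ-≡ (toℕ l') (suc (toℕ l)) (sym next) with faceUp l'
    ... | true  = refl
    ... | false = refl
    off : ∀ t → t ≢ position l → t ≢ position l' → −image (suc l) t ≡ + 0
    off t t≢ t≢' rewrite −image-at (suc l) t | simpleRoot-inner m l inner (label t)
      | ≡ᵇ-≢ (toℕ (label t)) (toℕ l) (λ e → label≢ t l t≢ (FP.toℕ-injective e))
      | ≡ᵇ-≢ (toℕ (label t)) (suc (toℕ l)) (λ e → label≢ t l' t≢' (FP.toℕ-injective (trans e next))) with neg σ t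
    ... | true  = refl
    ... | false = refl

sumℤ-zero : ∀ {n} (f : Fin n → ℤ) → (∀ i → f i ≡ + 0) → sumℤ f ≡ + 0
sumℤ-zero {zero}  f f≡0 = refl
sumℤ-zero {suc n} f f≡0 rewrite f≡0 zero = trans (ZP.+-identityˡ _) (sumℤ-zero (λ i → f (suc i)) (λ i → f≡0 (suc i)))

sumℤ-at : ∀ {n} (f : Fin n → ℤ) a → (∀ t → t ≢ a → f t ≡ + 0) → sumℤ f ≡ f a
sumℤ-at {suc n} f zero    off = trans (cong (λ x → f zero ℤ.+ x) (sumℤ-zero _ (λ i → off (suc i) (λ ())))) (ZP.+-identityʳ _)
sumℤ-at {suc n} f (suc a) off rewrite off zero (λ ()) =
  trans (ZP.+-identityˡ _) (sumℤ-at (λ i → f (suc i)) a (λ t t≢a → off (suc t) (λ e → t≢a (FP.suc-injective e))))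

sumℤ-at₂ : ∀ {n} (f : Fin n → ℤ) a b → a ≢ b → (∀ t → t ≢ a → t ≢ b → f t ≡ + 0) → sumℤ f ≡ f a ℤ.+ f b
sumℤ-at₂ {suc n} f zero    zero    a≢b off = ⊥-elim (a≢b refl)
sumℤ-at₂ {suc n} f zero    (suc b) a≢b off =
  cong (λ x → f zero ℤ.+ x) (sumℤ-at (λ i → f (suc i)) b (λ t t≢b → off (suc t) (λ ()) (λ e → t≢b (FP.suc-injective e))))
sumℤ-at₂ {suc n} f (suc a) zero    a≢b off =
  trans (cong (λ x → f zero ℤ.+ x) (sumℤ-at (λ i → f (suc i)) a (λ t t≢a → off (suc t) (λ e → t≢a (FP.suc-injective e)) (λ ()))))
        (ZP.+-comm (f zero) _)
sumℤ-at₂ {suc n} f (suc a) (suc b) a≢b off rewrite off zero (λ ()) (λ ()) =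
  trans (ZP.+-identityˡ _) (sumℤ-at₂ (λ i → f (suc i)) a b (λ e → a≢b (cong suc e))
    (λ t t≢a t≢b → off (suc t) (λ e → t≢a (FP.suc-injective e)) (λ e → t≢b (FP.suc-injective e))))

module Pairings (m : ℕ) (y : Vec ℤ (suc m)) where

  ⟪-α₀,y⟫ : ⟪ (λ j → - simpleRoot m zero j) , y ⟫ ≡ + 2 ℤ.* lookup y zero
  ⟪-α₀,y⟫ = sumℤ-at _ zero off
    where
    off : ∀ t → t ≢ zero → (- simpleRoot m zero t) ℤ.* lookup y t ≡ + 0
    off t t≢0 rewrite ≡ᵇ-≢ (toℕ t) 0 (λ e → t≢0 (FP.toℕ-injective e)) = refl

  ⟪αₙ,y⟫ : ∀ (l : Fin (suc m)) → toℕ l ≡ m → ⟪ simpleRoot m (suc l) , y ⟫ ≡ + 2 ℤ.* lookup y l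
  ⟪αₙ,y⟫ l l≡m = trans (sumℤ-at _ l off)
    (cong (ℤ._* lookup y l) (trans (root l) (cong (λ b → if b then + 2 else + 0) (≡ᵇ-≡ (toℕ l) (toℕ l) refl))))
    where
    root : ∀ x → simpleRoot m (suc l) x ≡ (if toℕ x ≡ᵇ toℕ l then + 2 else + 0)
    root = simpleRoot-last m l (≡ᵇ-≡ (toℕ l) m l≡m)
    off : ∀ t → t ≢ l → simpleRoot m (suc l) t ℤ.* lookup y t ≡ + 0
    off t t≢l rewrite root t | ≡ᵇ-≢ (toℕ t) (toℕ l) (λ e → t≢l (FP.toℕ-injective e)) = refl

  ⟪αᵢ,y⟫ : ∀ (l l' : Fin (suc m)) → suc (toℕ l) ≡ toℕ l' → ⟪ simpleRoot m (suc l) , y ⟫ ≡ lookup y l ℤ.- lookup y l'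
  ⟪αᵢ,y⟫ l l' next = trans (sumℤ-at₂ _ l l' l≢l' off) (cong₂ ℤ._+_ at-l at-l')
    where
    inner : (toℕ l ≡ᵇ m) ≡ false
    inner = not-last m l l' next
    root : ∀ x → simpleRoot m (suc l) x ≡ (if toℕ x ≡ᵇ toℕ l then + 1 else (if toℕ x ≡ᵇ suc (toℕ l) then - (+ 1) else + 0))
    root = simpleRoot-inner m l inner
    l≢l' : l ≢ l'
    l≢l' e = NP.<-irrefl (cong toℕ e) (subst (toℕ l ℕ.<_) next (NP.n<1+n _))
    off : ∀ t → t ≢ l → t ≢ l' → simpleRoot m (suc l) t ℤ.* lookup y t ≡ + 0
    off t t≢l t≢l' rewrite root t | ≡ᵇ-≢ (toℕ t) (toℕ l) (λ e → t≢l (FP.toℕ-injective e))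
                         | ≡ᵇ-≢ (toℕ t) (suc (toℕ l)) (λ e → t≢l' (FP.toℕ-injective (trans e next))) = refl
    at-l : simpleRoot m (suc l) l ℤ.* lookup y l ≡ lookup y l
    at-l rewrite root l | ≡ᵇ-≡ (toℕ l) (toℕ l) refl = ZP.*-identityˡ _
    at-l' : simpleRoot m (suc l) l' ℤ.* lookup y l' ≡ - lookup y l'
    at-l' rewrite root l' | ≡ᵇ-≢ (toℕ l') (toℕ l) (λ e → NP.<-irrefl (trans (sym e) (sym next)) (NP.n<1+n _))
                | ≡ᵇ-≡ (toℕ l') (suc (toℕ l)) (sym next) = ZP.-1*i≡-i _

-- The lattice points counted by x_k(σ⁻¹)

private
  0<i-j⇒j<i : ∀ i j → + 0 ℤ.< i ℤ.- j → j ℤ.< i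
  0<i-j⇒j<i i j 0<i-j = subst₂ ℤ._<_ (ZP.+-identityˡ j) i-j+j≡i (ZP.+-monoˡ-< j 0<i-j)
    where
    i-j+j≡i : (i ℤ.- j) ℤ.+ j ≡ i
    i-j+j≡i = trans (ZP.+-assoc i (- j) j) (trans (cong (λ x → i ℤ.+ x) (ZP.+-inverseˡ j)) (ZP.+-identityʳ i))

  j<i⇒0<i-j : ∀ i j → j ℤ.< i → + 0 ℤ.< i ℤ.- j
  j<i⇒0<i-j i j j<i = subst (ℤ._< i ℤ.- j) (ZP.+-inverseʳ j) (ZP.+-monoˡ-< (- j) j<i)

  2*≡0 : ∀ a → + 2 ℤ.* a ≡ + 0 → a ≡ + 0
  2*≡0 a eq with ZP.i*j≡0⇒i≡0∨j≡0 (+ 2) eq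
  ... | inj₂ a≡0 = a≡0

pairing : ∀ m → Vec ℤ (suc m) → Fin (suc (suc m)) → ℤ
pairing m y zero    = ⟪ (λ j → - simpleRoot m zero j) , y ⟫
pairing m y (suc l) = ⟪ simpleRoot m (suc l) , y ⟫

wall : ∀ {m} → ℕ → Fin (suc (suc m)) → ℤ
wall k zero    = + k
wall k (suc l) = + 0

-- The only candidate for the set I with ACond m k I y: the walls on which y lies.
walls : ∀ m k → Vec ℤ (suc m) → Subset (suc (suc m))
walls m k y = Vec.tabulate (λ a → does (pairing m y a ℤ.≟ wall k a))

∈walls⇔ : ∀ m k y a → a ∈ walls m k y ⇔ pairing m y a ≡ wall k a
∈walls⇔ m k y a = mk⇔
  (λ a∈ → does⇒ (pairing m y a ℤ.≟ wall k a) (trans (sym (VP.lookup∘tabulate on a)) (VP.[]=⇒lookup a∈)))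
  (λ eq → VP.lookup⇒[]= a _ (trans (VP.lookup∘tabulate on a) (dec-true (pairing m y a ℤ.≟ wall k a) eq)))
  where
  on : Fin (suc (suc m)) → Bool
  on a = does (pairing m y a ℤ.≟ wall k a)
  does⇒ : ∀ {P : Set} (d : Dec P) → does d ≡ true → P
  does⇒ (yes p) _ = p

ACond⇒≡walls : ∀ m k y I → ACond m k I y → I ≡ walls m k y
ACond⇒≡walls m k y I (on₀ , below₀ , walls-i) = ⊆-antisym
  (λ {a} a∈I → Equivalence.from (∈walls⇔ m k y a) (on a a∈I))
  (λ {a} a∈W → in-I a (Equivalence.to (∈walls⇔ m k y a) a∈W))
  where
  on : ∀ a → a ∈ I → pairing m y a ≡ wall k a
  on zero    = on₀
  on (suc l) = proj₁ (walls-i l)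
  in-I : ∀ a → pairing m y a ≡ wall k a → a ∈ I
  in-I zero    eq with zero ∈? I
  ... | yes z∈ = z∈
  ... | no z∉  = ⊥-elim (ZP.<-irrefl eq (below₀ z∉))
  in-I (suc l) eq with suc l ∈? I
  ... | yes l∈ = l∈
  ... | no l∉  = ⊥-elim (ZP.<-irrefl (sym eq) (proj₂ (walls-i l) l∉))

module Lattice (m k' : ℕ) (σ : SignedPerm (suc m)) where

  open Labelling {suc m} σ
  open Descents m σ using (w; α₀∈Cdes⇔; αₙ∈Cdes⇔; αᵢ∈Cdes⇔)

  k : ℕ
  k = suc k'

  allowed : List (Subset (suc (suc m)))
  allowed = filter (avoidsCdes? m w) (allSubsets (suc (suc m)))

  InAllowedRegion : Vec ℤ (suc m) → Set
  InAllowedRegion y = ∃ λ I → I ∈ₗ allowed × ACond m k I y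

  record LatticeAdmissible (y : Vec ℤ (suc m)) : Set where
    field
      top    : + 2 ℤ.* lookup y zero ℤ.< + k ⊎ (+ 2 ℤ.* lookup y zero ≡ + k × faceUp zero ≡ true)
      bottom : ∀ l → toℕ l ≡ m → + 0 ℤ.< lookup y l ⊎ (lookup y l ≡ + 0 × faceUp l ≡ false)
      step   : ∀ l l' → suc (toℕ l) ≡ toℕ l' →
               lookup y l' ℤ.< lookup y l ⊎ (lookup y l ≡ lookup y l' × Ascent (faceUp l) (faceUp l') (position l) (position l'))

  private
    successor : ∀ (l : Fin (suc m)) → toℕ l ≢ m → ∃ λ l' → suc (toℕ l) ≡ toℕ l'
    successor l l≢m = fromℕ< l+1<n , sym (FP.toℕ-fromℕ< l+1<n)
      where
      l+1<n : suc (toℕ l) < suc m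
      l+1<n = ℕ.s≤s (NP.≤∧≢⇒< (NP.≤-pred (FP.toℕ<n l)) l≢m)

  region⇒LatticeAdmissible : ∀ y → InAllowedRegion y → LatticeAdmissible y
  region⇒LatticeAdmissible y (I , I∈ , on₀ , below₀ , walls-i) = record { top = top ; bottom = bottom ; step = step }
    where
    open Pairings m y
    avoids : AvoidsCdes m w I
    avoids = proj₂ (MP.∈-filter⁻ (avoidsCdes? m w) {xs = allSubsets (suc (suc m))} I∈)
    top : + 2 ℤ.* lookup y zero ℤ.< + k ⊎ (+ 2 ℤ.* lookup y zero ≡ + k × faceUp zero ≡ true)
    top with zero ∈? I
    ... | yes 0∈ = inj₂ (trans (sym ⟪-α₀,y⟫) (on₀ 0∈) , up)
      where
      up : faceUp zero ≡ true
      up with faceUp zero in e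
      ... | true  = refl
      ... | false = ⊥-elim (avoids zero 0∈ (Equivalence.from α₀∈Cdes⇔ e))
    ... | no 0∉  = inj₁ (subst (ℤ._< + k) ⟪-α₀,y⟫ (below₀ 0∉))
    bottom : ∀ l → toℕ l ≡ m → + 0 ℤ.< lookup y l ⊎ (lookup y l ≡ + 0 × faceUp l ≡ false)
    bottom l l≡m with suc l ∈? I
    ... | yes l∈ = inj₂ (2*≡0 _ (trans (sym (⟪αₙ,y⟫ l l≡m)) (proj₁ (walls-i l) l∈)) , down)
      where
      down : faceUp l ≡ false
      down with faceUp l in e
      ... | false = refl
      ... | true  = ⊥-elim (avoids (suc l) l∈ (Equivalence.from (αₙ∈Cdes⇔ l l≡m) e))
    ... | no l∉  = inj₁ (ZP.*-cancelˡ-<-nonNeg (+ 2) (subst (+ 0 ℤ.<_) (⟪αₙ,y⟫ l l≡m) (proj₂ (walls-i l) l∉)))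
    step : ∀ l l' → suc (toℕ l) ≡ toℕ l' →
      lookup y l' ℤ.< lookup y l ⊎ (lookup y l ≡ lookup y l' × Ascent (faceUp l) (faceUp l') (position l) (position l'))
    step l l' next with suc l ∈? I
    ... | yes l∈ = inj₂ (ZP.i-j≡0⇒i≡j _ _ (trans (sym (⟪αᵢ,y⟫ l l' next)) (proj₁ (walls-i l) l∈)) ,
                         decidable-stable (Ascent? _ _ _ _) (λ ¬asc → avoids (suc l) l∈ (Equivalence.from (αᵢ∈Cdes⇔ l l' next) ¬asc)))
    ... | no l∉  = inj₁ (0<i-j⇒j<i _ _ (subst (+ 0 ℤ.<_) (⟪αᵢ,y⟫ l l' next) (proj₂ (walls-i l) l∉)))

  LatticeAdmissible⇒region : ∀ y → LatticeAdmissible y → InAllowedRegion y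
  LatticeAdmissible⇒region y adm = walls m k y , walls∈allowed , on zero , below₀ , λ l → on (suc l) , below-i l
    where
    open Pairings m y
    open LatticeAdmissible adm
    on : ∀ a → a ∈ walls m k y → pairing m y a ≡ wall k a
    on a = Equivalence.to (∈walls⇔ m k y a)
    off : ∀ a → a ∉ walls m k y → pairing m y a ≢ wall k a
    off a a∉ eq = a∉ (Equivalence.from (∈walls⇔ m k y a) eq)
    on-wall⇒¬Cdes : ∀ a → pairing m y a ≡ wall k a → ¬ InCdes m w a
    on-wall⇒¬Cdes zero eq with top
    ... | inj₁ lt        = ⊥-elim (ZP.<-irrefl (trans (sym ⟪-α₀,y⟫) eq) lt)
    ... | inj₂ (_ , up)  = λ c → true≢false (trans (sym up) (Equivalence.to α₀∈Cdes⇔ c))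
    on-wall⇒¬Cdes (suc l) eq with toℕ l ℕ.≟ m
    ... | yes l≡m with bottom l l≡m
    ...   | inj₁ lt          = ⊥-elim (ZP.<-irrefl (sym (2*≡0 _ (trans (sym (⟪αₙ,y⟫ l l≡m)) eq))) lt)
    ...   | inj₂ (_ , down)  = λ c → true≢false (trans (sym (Equivalence.to (αₙ∈Cdes⇔ l l≡m) c)) down)
    on-wall⇒¬Cdes (suc l) eq | no l≢m with successor l l≢m
    ... | l' , next with step l l' next
    ...   | inj₁ lt          = ⊥-elim (ZP.<-irrefl (sym (ZP.i-j≡0⇒i≡j _ _ (trans (sym (⟪αᵢ,y⟫ l l' next)) eq))) lt)
    ...   | inj₂ (_ , asc)   = λ c → Equivalence.to (αᵢ∈Cdes⇔ l l' next) c asc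
    walls∈allowed : walls m k y ∈ₗ allowed
    walls∈allowed = MP.∈-filter⁺ (avoidsCdes? m w)
      (∈-allVec (λ { true → here refl ; false → there (here refl) }) (walls m k y))
      (λ a a∈ → on-wall⇒¬Cdes a (on a a∈))
    below₀ : zero ∉ walls m k y → ⟪ (λ j → - simpleRoot m zero j) , y ⟫ ℤ.< + k
    below₀ 0∉ with top
    ... | inj₁ lt       = subst (ℤ._< + k) (sym ⟪-α₀,y⟫) lt
    ... | inj₂ (eq , _) = ⊥-elim (off zero 0∉ (trans ⟪-α₀,y⟫ eq))
    below-i : ∀ l → suc l ∉ walls m k y → + 0 ℤ.< ⟪ simpleRoot m (suc l) , y ⟫
    below-i l l∉ with toℕ l ℕ.≟ m
    ... | yes l≡m with bottom l l≡m
    ...   | inj₁ lt       = subst (+ 0 ℤ.<_) (sym (⟪αₙ,y⟫ l l≡m)) (ZP.*-monoˡ-<-pos (+ 2) lt)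
    ...   | inj₂ (eq , _) = ⊥-elim (off (suc l) l∉ (trans (⟪αₙ,y⟫ l l≡m) (cong (+ 2 ℤ.*_) eq)))
    below-i l l∉ | no l≢m with successor l l≢m
    ... | l' , next with step l l' next
    ...   | inj₁ lt       = subst (+ 0 ℤ.<_) (sym (⟪αᵢ,y⟫ l l' next)) (j<i⇒0<i-j _ _ lt)
    ...   | inj₂ (eq , _) = ⊥-elim (off (suc l) l∉ (trans (⟪αᵢ,y⟫ l l' next)
                              (trans (cong (ℤ._- lookup y l') eq) (ZP.+-inverseʳ (lookup y l')))))

module Correspondence (m k' : ℕ) (σ : SignedPerm (suc m)) where

  open Halving m k' σ
  open Lattice m k' σ using (LatticeAdmissible; InAllowedRegion; region⇒LatticeAdmissible; LatticeAdmissible⇒region)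

  toLattice : (Fin (suc m) → ℕ) → Vec ℤ (suc m)
  toLattice h = Vec.tabulate (λ l → + h l)

  lookup-toLattice : ∀ h l → lookup (toLattice h) l ≡ + h l
  lookup-toLattice h l = VP.lookup∘tabulate (λ l → + h l) l

  2*-lookup-toLattice : ∀ h l → + 2 ℤ.* lookup (toLattice h) l ≡ + (2 ℕ.* h l)
  2*-lookup-toLattice h l = trans (cong (+ 2 ℤ.*_) (lookup-toLattice h l)) (sym (ZP.pos-* 2 (h l)))

  toLattice-Admissible : ∀ h → HalfAdmissible h → LatticeAdmissible (toLattice h)
  toLattice-Admissible h half .LatticeAdmissible.top with HalfAdmissible.top half
  ... | inj₁ lt        = inj₁ (subst (ℤ._< + k) (sym (2*-lookup-toLattice h zero)) (+<+ lt))
  ... | inj₂ (eq , up) = inj₂ (trans (2*-lookup-toLattice h zero) (cong +_ eq) , up)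
  toLattice-Admissible h half .LatticeAdmissible.bottom l l≡m with HalfAdmissible.bottom half l l≡m
  ... | inj₁ lt          = inj₁ (subst (+ 0 ℤ.<_) (sym (lookup-toLattice h l)) (+<+ lt))
  ... | inj₂ (eq , down) = inj₂ (trans (lookup-toLattice h l) (cong +_ eq) , down)
  toLattice-Admissible h half .LatticeAdmissible.step l l' next with HalfAdmissible.step half l l' next
  ... | inj₁ lt         = inj₁ (subst₂ ℤ._<_ (sym (lookup-toLattice h l')) (sym (lookup-toLattice h l)) (+<+ lt))
  ... | inj₂ (eq , asc) = inj₂ (trans (lookup-toLattice h l) (trans (cong +_ eq) (sym (lookup-toLattice h l'))) , asc)

  module FromLattice (y : Vec ℤ (suc m)) (adm : LatticeAdmissible y) where

    open LatticeAdmissible adm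

    private
      last≥0 : + 0 ℤ.≤ lookup y last
      last≥0 with bottom last (FP.toℕ-fromℕ m)
      ... | inj₁ lt       = ZP.<⇒≤ lt
      ... | inj₂ (eq , _) = ZP.≤-reflexive (sym eq)

      decreasing : ∀ a b → suc (toℕ a) ≡ toℕ b → lookup y b ℤ.≤ lookup y a
      decreasing a b next with step a b next
      ... | inj₁ lt       = ZP.<⇒≤ lt
      ... | inj₂ (eq , _) = ZP.≤-reflexive (sym eq)

    nonNegative : ∀ l → + 0 ℤ.≤ lookup y l
    nonNegative l with toℕ l ℕ.≟ m
    ... | yes l≡m = subst (λ l → + 0 ℤ.≤ lookup y l) (FP.toℕ-injective (trans (FP.toℕ-fromℕ m) (sym l≡m))) last≥0
    ... | no l≢m  = ZP.≤-trans last≥0 (<-chain (λ a b → lookup y b ℤ.≤ lookup y a) (λ ab bc → ZP.≤-trans bc ab) decreasing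
                      l last (subst (toℕ l <_) (sym (FP.toℕ-fromℕ m)) (NP.≤∧≢⇒< (NP.≤-pred (FP.toℕ<n l)) l≢m)))

    h : Fin (suc m) → ℕ
    h l = ∣ lookup y l ∣

    +h : ∀ l → + h l ≡ lookup y l
    +h l = ZP.0≤i⇒+∣i∣≡i (nonNegative l)

    toLattice-h : toLattice h ≡ y
    toLattice-h = trans (VP.tabulate-cong +h) (VP.tabulate∘lookup y)

    private
      2*y₀ : + 2 ℤ.* lookup y zero ≡ + (2 ℕ.* h zero)
      2*y₀ = trans (cong (λ v → + 2 ℤ.* lookup v zero) (sym toLattice-h)) (2*-lookup-toLattice h zero)

    h-HalfAdmissible : HalfAdmissible h
    h-HalfAdmissible .HalfAdmissible.top with top
    ... | inj₁ lt        = inj₁ (ZP.drop‿+<+ (subst (ℤ._< + k) 2*y₀ lt))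
    ... | inj₂ (eq , up) = inj₂ (ZP.+-injective (trans (sym 2*y₀) eq) , up)
    h-HalfAdmissible .HalfAdmissible.bottom l l≡m with bottom l l≡m
    ... | inj₁ lt          = inj₁ (ZP.drop‿+<+ (subst (+ 0 ℤ.<_) (sym (+h l)) lt))
    ... | inj₂ (eq , down) = inj₂ (ZP.+-injective (trans (+h l) eq) , down)
    h-HalfAdmissible .HalfAdmissible.step l l' next with step l l' next
    ... | inj₁ lt         = inj₁ (ZP.drop‿+<+ (subst₂ ℤ._<_ (sym (+h l')) (sym (+h l)) lt))
    ... | inj₂ (eq , asc) = inj₂ (ZP.+-injective (trans (+h l) (trans eq (sym (+h l')))) , asc)

  Φ : Vec (Fin k) (suc m) → Vec ℤ (suc m)
  Φ u = toLattice (λ l → ⌈ heights u l /2⌉)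

  Φ-into : ∀ u → Produces u → InAllowedRegion (Φ u)
  Φ-into u produces = LatticeAdmissible⇒region (Φ u) (toLattice-Admissible _
    (halve-Admissible (heights u) (heights-Admissible u (Equivalence.to (Produces⇔ u) produces))))

  Φ-onto : ∀ y → InAllowedRegion y → ∃ λ u → Produces u × Φ u ≡ y
  Φ-onto y region = word , Equivalence.from (Produces⇔ word) word-produces , Φ-word
    where
    open FromLattice y (region⇒LatticeAdmissible y region)
    open Unhalving h h-HalfAdmissible
    open FromHeights (suc m) k' σ g g-Admissible using (word; word-produces; heights-word)
    Φ-word : Φ word ≡ y
    Φ-word = trans (VP.tabulate-cong (λ l → cong +_ (trans (cong ⌈_/2⌉ (heights-word l)) (⌈g/2⌉ l)))) toLattice-h

  Φ-injective : ∀ u u' → Produces u → Produces u' → Φ u ≡ Φ u' → u ≡ u'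
  Φ-injective u u' produces produces' Φ≡ = heights-injective u u' λ l →
    ⌈/2⌉-injective (heights u l) (heights u' l) (half≡ l) (trans (parity adm l) (sym (parity adm' l)))
    where
    open Admissible using (parity)
    adm : Admissible (heights u)
    adm = heights-Admissible u (Equivalence.to (Produces⇔ u) produces)
    adm' : Admissible (heights u')
    adm' = heights-Admissible u' (Equivalence.to (Produces⇔ u') produces')
    half≡ : ∀ l → ⌈ heights u l /2⌉ ≡ ⌈ heights u' l /2⌉
    half≡ l = ZP.+-injective (trans (sym (lookup-toLattice (λ l → ⌈ heights u l /2⌉) l))
                (trans (cong (λ v → lookup v l) Φ≡) (lookup-toLattice (λ l → ⌈ heights u' l /2⌉) l)))

-- Counting words with prescribed letter counts

sum-allFin : ∀ {k} (f : Fin k → ℕ) → sum (List.map f (allFin k)) ≡ ∑ f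
sum-allFin {k} f = trans (cong sum (LP.map-tabulate (λ i → i) f)) (sum-tabulate f)
  where
  sum-tabulate : ∀ {k} (f : Fin k → ℕ) → sum (List.tabulate f) ≡ ∑ f
  sum-tabulate {zero}  f = refl
  sum-tabulate {suc k} f = cong (f zero ℕ.+_) (sum-tabulate (λ i → f (suc i)))

Vec-sum≡∑ : ∀ {k} (j : Vec ℕ k) → Vec.sum j ≡ ∑ (lookup j)
Vec-sum≡∑ []      = refl
Vec-sum≡∑ (x ∷ j) = cong (x ℕ.+_) (Vec-sum≡∑ j)

lookup≤sum : ∀ {k} (j : Vec ℕ k) r → lookup j r ≤ Vec.sum j
lookup≤sum (a ∷ j) zero    = NP.m≤m+n a _
lookup≤sum (a ∷ j) (suc r) = NP.≤-trans (lookup≤sum j r) (NP.m≤n+m _ a)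

sum-update : ∀ {k} (j : Vec ℕ k) x v → Vec.sum (j [ x ]≔ v) ℕ.+ lookup j x ≡ Vec.sum j ℕ.+ v
sum-update (a ∷ j) zero    v = solve-∀′ v (Vec.sum j) a
  where solve-∀′ : ∀ v s a → v ℕ.+ s ℕ.+ a ≡ a ℕ.+ s ℕ.+ v
        solve-∀′ = solve-∀
sum-update (a ∷ j) (suc x) v = trans (NP.+-assoc a _ _) (trans (cong (a ℕ.+_) (sum-update j x v)) (sym (NP.+-assoc a _ _)))

∏! : ∀ {k} → Vec ℕ k → ℕ
∏! j = product (List.map _! (Vec.toList j))

∏!-update : ∀ {k} (j : Vec ℕ k) x v → ∏! (j [ x ]≔ v) ℕ.* lookup j x ! ≡ ∏! j ℕ.* v !
∏!-update (a ∷ j) zero    v = swap (v !) (∏! j) (a !)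
  where swap : ∀ p q r → p ℕ.* q ℕ.* r ≡ r ℕ.* q ℕ.* p
        swap = solve-∀
∏!-update (a ∷ j) (suc x) v =
  trans (NP.*-assoc (a !) _ _) (trans (cong (a ! ℕ.*_) (∏!-update j x v)) (sym (NP.*-assoc (a !) _ _)))

∏!-replicate-0 : ∀ {k} → ∏! (Vec.replicate k 0) ≡ 1
∏!-replicate-0 {zero}  = refl
∏!-replicate-0 {suc k} = trans (NP.+-identityʳ _) (∏!-replicate-0 {k})

∏!-step : ∀ {k} (j : Vec ℕ k) x c → lookup j x ≡ suc c → ∏! j ≡ ∏! (j [ x ]≔ c) ℕ.* suc c
∏!-step j x c jx≡ = sym (NP.*-cancelʳ-≡ _ _ (c !) {{c NP.!≢0}} (begin
  ∏! (j [ x ]≔ c) ℕ.* suc c ℕ.* c !   ≡⟨ NP.*-assoc (∏! (j [ x ]≔ c)) (suc c) (c !) ⟩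
  ∏! (j [ x ]≔ c) ℕ.* suc c !         ≡⟨ cong (λ v → ∏! (j [ x ]≔ c) ℕ.* v !) jx≡ ⟨
  ∏! (j [ x ]≔ c) ℕ.* lookup j x !    ≡⟨ ∏!-update j x c ⟩
  ∏! j ℕ.* c !                        ∎))
  where open ≡-Reasoning

module _ {k : ℕ} where

  lookup-counts-∷ : ∀ {n} x (u : Vec (Fin k) n) r → lookup (counts (x ∷ u)) r ≡ indicator (r Fin.≟ x) ℕ.+ lookup (counts u) r
  lookup-counts-∷ x u r rewrite VP.lookup∘tabulate (λ r → Vec.count (r Fin.≟_) (x ∷ u)) r
                              | VP.lookup∘tabulate (λ r → Vec.count (r Fin.≟_) u) r with r Fin.≟ x
  ... | yes _ = refl
  ... | no _  = refl

  counts-∷⇔ : ∀ {n} x (u : Vec (Fin k) n) (j : Vec ℕ k) c → lookup j x ≡ suc c →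
    counts (x ∷ u) ≡ j ⇔ counts u ≡ j [ x ]≔ c
  counts-∷⇔ x u j c jx≡ = mk⇔
    (λ eq → Pointwise-≡⇒≡ (ext λ r → ⇒ r eq))
    (λ eq → Pointwise-≡⇒≡ (ext λ r → ⇐ r eq))
    where
    ⇒ : ∀ r → counts (x ∷ u) ≡ j → lookup (counts u) r ≡ lookup (j [ x ]≔ c) r
    ⇒ r eq with r Fin.≟ x | lookup-counts-∷ x u r
    ... | yes refl | cnt = trans (NP.suc-injective (trans (sym cnt) (trans (cong (λ v → lookup v x) eq) jx≡)))
                                 (sym (VP.lookup∘update x j c))
    ... | no r≢x   | cnt = trans (sym cnt) (trans (cong (λ v → lookup v r) eq) (sym (VP.lookup∘update′ r≢x j c)))
    ⇐ : ∀ r → counts u ≡ j [ x ]≔ c → lookup (counts (x ∷ u)) r ≡ lookup j r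
    ⇐ r eq with r Fin.≟ x | lookup-counts-∷ x u r
    ... | yes refl | cnt = trans cnt (trans (cong suc (trans (cong (λ v → lookup v x) eq) (VP.lookup∘update x j c))) (sym jx≡))
    ... | no r≢x   | cnt = trans cnt (trans (cong (λ v → lookup v r) eq) (VP.lookup∘update′ r≢x j c))

  counts-∷≢ : ∀ {n} x (u : Vec (Fin k) n) (j : Vec ℕ k) → lookup j x ≡ 0 → counts (x ∷ u) ≢ j
  counts-∷≢ x u j jx≡0 eq with x Fin.≟ x | lookup-counts-∷ x u x
  ... | yes _   | cnt with () ← trans (sym cnt) (trans (cong (λ v → lookup v x) eq) jx≡0)
  ... | no x≢x  | _   = x≢x refl

  private
    length-interleavings-0 : (j : Vec ℕ k) → Vec.sum j ≡ 0 → length (interleavings 0 j) ℕ.* ∏! j ≡ 1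
    length-interleavings-0 j sum≡0 = begin
      length (interleavings 0 j) ℕ.* ∏! j    ≡⟨ cong₂ ℕ._*_ single (cong ∏! j≡0) ⟩
      1 ℕ.* ∏! (Vec.replicate k 0)           ≡⟨ cong (1 ℕ.*_) (∏!-replicate-0 {k}) ⟩
      1                                      ∎
      where
      open ≡-Reasoning
      lookup≡0 : ∀ r → lookup j r ≡ 0
      lookup≡0 r = NP.n≤0⇒n≡0 (subst (lookup j r ≤_) sum≡0 (lookup≤sum j r))
      j≡0 : j ≡ Vec.replicate k 0
      j≡0 = Pointwise-≡⇒≡ (ext λ r → trans (lookup≡0 r) (sym (VP.lookup-replicate r 0)))
      single : length (interleavings 0 j) ≡ 1
      single with VP.≡-dec ℕ._≟_ (counts {n = 0} []) j
      ... | yes _ = refl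
      ... | no ≢  = ⊥-elim (≢ (Pointwise-≡⇒≡ (ext λ r →
                      trans (VP.lookup∘tabulate (λ r → Vec.count (r Fin.≟_) (Vec.[] {A = Fin k})) r) (sym (lookup≡0 r)))))

    starting-with : ∀ n (j : Vec ℕ k) → Fin k → ℕ
    starting-with n j x = length (filter (λ u → VP.≡-dec ℕ._≟_ (counts (x ∷ u)) j) (allVec (allFin k) n))

    starting-with-* : ∀ n (j : Vec ℕ k) x → Vec.sum j ≡ suc n →
      (∀ j′ → Vec.sum j′ ≡ n → length (interleavings n j′) ℕ.* ∏! j′ ≡ n !) →
      starting-with n j x ℕ.* ∏! j ≡ lookup j x ℕ.* n !
    starting-with-* n j x sum≡ shorter with lookup j x in jx≡
    ... | zero  = cong (ℕ._* ∏! j) (length-filter-none _ (λ u → counts-∷≢ x u j jx≡) (allVec (allFin k) n))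
    ... | suc c = begin
      starting-with n j x ℕ.* ∏! j
        ≡⟨ cong₂ ℕ._*_ (length-filter-cong _ (λ u → VP.≡-dec ℕ._≟_ (counts u) j′) (λ u → counts-∷⇔ x u j c jx≡)
                                           (allVec (allFin k) n))
                       (∏!-step j x c jx≡) ⟩
      length (interleavings n j′) ℕ.* (∏! j′ ℕ.* suc c)
        ≡⟨ NP.*-assoc (length (interleavings n j′)) (∏! j′) (suc c) ⟨
      length (interleavings n j′) ℕ.* ∏! j′ ℕ.* suc c
        ≡⟨ cong (ℕ._* suc c) (shorter j′ sum′) ⟩
      n ! ℕ.* suc c
        ≡⟨ NP.*-comm (n !) (suc c) ⟩
      suc c ℕ.* n ! ∎
      where
      open ≡-Reasoning
      j′ : Vec ℕ k
      j′ = j [ x ]≔ c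
      sum′ : Vec.sum j′ ≡ n
      sum′ = NP.+-cancelʳ-≡ (suc c) _ _ (begin
        Vec.sum j′ ℕ.+ suc c         ≡⟨ cong (Vec.sum j′ ℕ.+_) jx≡ ⟨
        Vec.sum j′ ℕ.+ lookup j x    ≡⟨ sum-update j x c ⟩
        Vec.sum j ℕ.+ c              ≡⟨ cong (ℕ._+ c) sum≡ ⟩
        suc n ℕ.+ c                  ≡⟨ NP.+-suc n c ⟨
        n ℕ.+ suc c                  ∎)

  length-interleavings : ∀ n (j : Vec ℕ k) → Vec.sum j ≡ n → length (interleavings n j) ℕ.* ∏! j ≡ n !
  length-interleavings zero    j sum≡ = length-interleavings-0 j sum≡
  length-interleavings (suc n) j sum≡ = begin
    length (interleavings (suc n) j) ℕ.* ∏! j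
      ≡⟨ cong (ℕ._* ∏! j) (trans (length-filter-concatMap P? (λ x → List.map (x ∷_) words) (allFin k))
                                 (cong sum (LP.map-cong (λ x → length-filter-map P? (x ∷_) words) (allFin k)))) ⟩
    sum (List.map (starting-with n j) (allFin k)) ℕ.* ∏! j
      ≡⟨ sum-map-*ʳ (starting-with n j) (∏! j) (allFin k) ⟩
    sum (List.map (λ x → starting-with n j x ℕ.* ∏! j) (allFin k))
      ≡⟨ sum-allFin (λ x → starting-with n j x ℕ.* ∏! j) ⟩
    ∑ (λ x → starting-with n j x ℕ.* ∏! j)
      ≡⟨ ∑-cong (λ x → starting-with-* n j x sum≡ (length-interleavings n)) ⟩
    ∑ (λ x → lookup j x ℕ.* n !)
      ≡⟨ ∑-*ʳ (lookup j) (n !) ⟨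
    ∑ (lookup j) ℕ.* n !
      ≡⟨ cong (ℕ._* n !) (trans (sym (Vec-sum≡∑ j)) sum≡) ⟩
    suc n ℕ.* n ! ∎
    where
    open ≡-Reasoning
    words : List (Vec (Fin k) n)
    words = allVec (allFin k) n
    P? : ∀ (u : Vec (Fin k) (suc n)) → Dec (counts u ≡ j)
    P? u = VP.≡-dec ℕ._≟_ (counts u) j

  Vec-sum-counts : ∀ {n} (u : Vec (Fin k) n) → Vec.sum (counts u) ≡ n
  Vec-sum-counts {n} u = begin
    Vec.sum (counts u)                                   ≡⟨ Vec-sum≡∑ (counts u) ⟩
    ∑ (lookup (counts u))                                ≡⟨ ∑-cong (lookup-counts u) ⟩
    ∑ (λ r → ∑ (λ i → indicator (r Fin.≟ lookup u i)))   ≡⟨ ∑-comm (λ r i → indicator (r Fin.≟ lookup u i)) ⟩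
    ∑ (λ i → count (λ r → r Fin.≟ lookup u i))           ≡⟨ ∑-cong (λ i → count-≡ (lookup u i)) ⟩
    ∑ {n} (λ _ → 1)                                      ≡⟨ ∑-one n ⟩
    n                                                    ∎
    where
    open ≡-Reasoning
    ∑-one : ∀ n → ∑ {n} (λ _ → 1) ≡ n
    ∑-one zero    = refl
    ∑-one (suc n) = cong suc (∑-one n)

  Unique-compositions : ∀ n → Unique (compositions n k)
  Unique-compositions n = UniqueP.filter⁺ (λ j → Vec.sum j ℕ.≟ n)
    (UniqueP.map⁺ (λ {u} {v} eq → Pointwise-≡⇒≡ (ext λ i → FP.toℕ-injective
        (trans (sym (VP.lookup-map i toℕ u)) (trans (cong (λ w → lookup w i) eq) (VP.lookup-map i toℕ v)))))
      (Unique-allVec (UniqueP.allFin⁺ (suc n)) k))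

  counts∈compositions : ∀ {n} (u : Vec (Fin k) n) → counts u ∈ₗ compositions n k
  counts∈compositions {n} u = MP.∈-filter⁺ (λ j → Vec.sum j ℕ.≟ n)
    (subst (_∈ₗ _) toℕ-bounded (MP.∈-map⁺ (Vec.map toℕ) (∈-allVec MP.∈-allFin bounded)))
    (Vec-sum-counts u)
    where
    count<suc-n : ∀ r → lookup (counts u) r < suc n
    count<suc-n r = s≤s (subst (_≤ n) (sym (lookup-counts u r)) (count≤n (λ i → r Fin.≟ lookup u i)))
    bounded : Vec (Fin (suc n)) k
    bounded = Vec.tabulate (λ r → fromℕ< (count<suc-n r))
    toℕ-bounded : Vec.map toℕ bounded ≡ counts u
    toℕ-bounded = Pointwise-≡⇒≡ (ext λ r → trans (VP.lookup-map r toℕ bounded)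
      (trans (cong toℕ (VP.lookup∘tabulate (λ r → fromℕ< (count<suc-n r)) r)) (FP.toℕ-fromℕ< (count<suc-n r))))

n!≢0 : ∀ n → n ! ≢ 0
n!≢0 n = ℕ.≢-nonZero⁻¹ (n !) {{n NP.!≢0}}

-- L · P = n! makes n!/P = L, which cancels against the uniform choice among the L interleavings.
multinomial-cancel : ∀ n L P x (R : ℚ) → L ℕ.* P ≡ n ! → (ratio (n !) P ℚ.* R) ℚ.* ratio x L ≡ R ℚ.* ofℕ x
multinomial-cancel n zero    P       x R L*P≡n! = ⊥-elim (n!≢0 n (sym L*P≡n!))
multinomial-cancel n (suc l) zero    x R L*P≡n! = ⊥-elim (n!≢0 n (trans (sym L*P≡n!) (NP.*-zeroʳ (suc l))))
multinomial-cancel n (suc l) (suc p) x R L*P≡n! rewrite sym L*P≡n! = begin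
  (ratio (suc l ℕ.* suc p) (suc p) ℚ.* R) ℚ.* ratio x (suc l) ≡⟨ cong (λ q → (q ℚ.* R) ℚ.* ratio x (suc l)) (ratio-*-cancelʳ (suc l) p) ⟩
  (ofℕ (suc l) ℚ.* R) ℚ.* ratio x (suc l)                     ≡⟨ cong (ℚ._* ratio x (suc l)) (QP.*-comm (ofℕ (suc l)) R) ⟩
  (R ℚ.* ofℕ (suc l)) ℚ.* ratio x (suc l)                     ≡⟨ QP.*-assoc R (ofℕ (suc l)) (ratio x (suc l)) ⟩
  R ℚ.* (ofℕ (suc l) ℚ.* ratio x (suc l))                     ≡⟨ cong (R ℚ.*_) (ofℕ-*-ratio l x) ⟩
  R ℚ.* ofℕ x                                                 ∎
  where open ≡-Reasoning

module Counting (m k' : ℕ) (σ : SignedPerm (suc m)) (a : Subset (suc (suc m)) → ℕ)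
                (hasCard : ∀ I → HasCard (ACond m (suc k') I) (a I)) where

  private
    n k : ℕ
    n = suc m
    k = suc k'

  open Outcome n k σ using (Produces)
  open Lattice m k' σ using (allowed)
  open Correspondence m k' σ using (Φ; Φ-into; Φ-onto; Φ-injective)

  produces? : ∀ (j : Vec ℕ k) (u : Vec (Fin k) n) → Dec (interleave (Vec.toList u) (stacks n j) ≡ encode σ)
  produces? j u = deck-≟ (interleave (Vec.toList u) (stacks n j)) (encode σ)

  successes : Vec ℕ k → ℕ
  successes j = length (filter (produces? j) (interleavings n j))

  producing : List (Vec (Fin k) n)
  producing = filter (λ u → produces? (counts u) u) (allVec (allFin k) n)

  points : Subset (suc n) → List (Vec ℤ n)
  points I = proj₁ (hasCard I)

  ∈points⇔ : ∀ I y → y ∈ₗ points I ⇔ ACond m k I y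
  ∈points⇔ I y = proj₁ (proj₂ (proj₂ (hasCard I))) y

  sum-successes : sum (List.map successes (compositions n k)) ≡ length producing
  sum-successes = sum-over-fibres counts (Unique-compositions n) counts∈compositions
    (λ u j → VP.≡-dec ℕ._≟_ (counts u) j) produces? (allVec (allFin k) n)

  sum-a : sum (List.map a allowed) ≡ length (concatMap points allowed)
  sum-a = trans (cong sum (LP.map-cong (λ I → sym (proj₂ (proj₂ (proj₂ (hasCard I))))) allowed)) (sym (length-concatMap points allowed))

  length-producing : length producing ≡ length (concatMap points allowed)
  length-producing = length-≡-by-bijection Φ
    (UniqueP.filter⁺ (λ u → produces? (counts u) u) (Unique-allVec (UniqueP.allFin⁺ k) n))
    (Unique-concatMap points (λ I → proj₁ (proj₂ (hasCard I))) same-region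
      (UniqueP.filter⁺ (avoidsCdes? m (inv σ)) (Unique-allVec Unique-Bool (suc n))))
    (λ u∈ u'∈ → Φ-injective _ _ (produces u∈) (produces u'∈))
    (λ {u} u∈ → let (I , I∈ , acond) = Φ-into u (produces u∈) in
                Equivalence.from (∈-concatMap⇔ points allowed (Φ u)) (I , I∈ , Equivalence.from (∈points⇔ I (Φ u)) acond))
    (λ {y} y∈ → let (I , I∈ , y∈I) = Equivalence.to (∈-concatMap⇔ points allowed y) y∈
                    (u , prod , Φu≡y) = Φ-onto y (I , I∈ , Equivalence.to (∈points⇔ I y) y∈I) in
                u , MP.∈-filter⁺ (λ u → produces? (counts u) u) (∈-allVec MP.∈-allFin u) prod , Φu≡y)
    where
    Unique-Bool : Unique (true ∷ false ∷ [])
    Unique-Bool = ((λ ()) ∷ []) ∷ [] ∷ []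
    produces : ∀ {u} → u ∈ₗ producing → Produces u
    produces u∈ = proj₂ (MP.∈-filter⁻ (λ u → produces? (counts u) u) {xs = allVec (allFin k) n} u∈)
    same-region : ∀ I I' y → y ∈ₗ points I → y ∈ₗ points I' → I ≡ I'
    same-region I I' y y∈I y∈I' = trans (ACond⇒≡walls m k y I (Equivalence.to (∈points⇔ I y) y∈I))
                                        (sym (ACond⇒≡walls m k y I' (Equivalence.to (∈points⇔ I' y) y∈I')))

  prob≡ : prob n k σ ≡ ratio 1 (k ℕ.^ n) ℚ.* ofℕ (sum (List.map successes (compositions n k)))
  prob≡ = trans (cong sumℚ (LP.map-cong-local (All.tabulate λ {j} → term j)))
    (trans (sumℚ-*ˡ (ratio 1 (k ℕ.^ n)) (λ j → ofℕ (successes j)) (compositions n k))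
           (cong (ratio 1 (k ℕ.^ n) ℚ.*_) (sumℚ-ofℕ successes (compositions n k))))
    where
    term : ∀ j → j ∈ₗ compositions n k →
      (multinomial n j ℚ.* ratio 1 (k ℕ.^ n)) ℚ.* ratio (successes j) (length (interleavings n j))
        ≡ ratio 1 (k ℕ.^ n) ℚ.* ofℕ (successes j)
    term j j∈ = multinomial-cancel n (length (interleavings n j)) _ (successes j) _ (length-interleavings n j
      (proj₂ (MP.∈-filter⁻ (λ j → Vec.sum j ℕ.≟ n) {xs = List.map (Vec.map toℕ) (allVec (allFin (suc n)) k)} j∈)))

  xk≡ : xk m k a (inv σ) ≡ ratio 1 (k ℕ.^ n) ℚ.* ofℕ (sum (List.map a allowed))
  xk≡ = cong (ratio 1 (k ℕ.^ n) ℚ.*_) (sumℚ-ofℕ a allowed)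

proposition1 : (m k : ℕ) → 1 ≤ k → (σ : SignedPerm (suc m))
    → (a : Subset (suc (suc m)) → ℕ) → (∀ I → HasCard (ACond m k I) (a I))
    → prob (suc m) k σ ≡ xk m k a (inv σ)
proposition1 m (suc k') _ σ a hasCard = begin
  prob (suc m) (suc k') σ                                                  ≡⟨ prob≡ ⟩
  ratio 1 (suc k' ℕ.^ suc m) ℚ.* ofℕ (sum (List.map successes (compositions (suc m) (suc k'))))
    ≡⟨ cong (λ c → ratio 1 (suc k' ℕ.^ suc m) ℚ.* ofℕ c) (trans sum-successes (trans length-producing (sym sum-a))) ⟩
  ratio 1 (suc k' ℕ.^ suc m) ℚ.* ofℕ (sum (List.map a allowed))           ≡⟨ xk≡ ⟨
  xk m (suc k') a (inv σ)                                                  ∎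
  where
  open ≡-Reasoning
  open Counting m k' σ a hasCard
  open Lattice m k' σ using (allowed)
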